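{- Let $\omega=e^{2\pi i/3}$ and let $\Lambda=\mathbb{Z}[\omega]\subset\mathbb{C}\cong\mathbb{R}^2$ be the hexagonal lattice generated by $1$ and $\omega$. For $\alpha=a+b\omega$ with $a,b\in\mathbb{Z}$, $\alpha\neq0$, the sublattice $\alpha\Lambda$ is clean if and only if $\alpha\theta$ is a primitive element of $\mathbb{Z}[\omega]$, where $\theta=\omega-\bar\omega=\sqrt{ -3}$. Moreover, for a positive integer $c$, there is a clean sublattice of $\Lambda$ of index $c$ similar to $\Lambda$ if and only if $c$ is a product of primes $\equiv1\pmod 3$.
   Context: A sublattice $\Lambda'\subseteq\Lambda$ is clean if the boundaries of the Voronoi cells of $\Lambda'$ (in $\mathbb{R}^2$) contain no point of $\Lambda$. An element $r+s\omega\in\mathbb{Z}[\omega]$ ($r,s\in\mathbb{Z}$) is primitive if $\gcd(r,s)=1$. A sublattice similar to $\Lambda$ is one of the form $\sigma(\Lambda)\subseteq\Lambda$ for a linear map $\sigma$ with $\sigma u\cdot\sigma v=c\,u\cdot v$ for some $c>0$. -}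

module Defs where

open import Data.Nat as ℕ using (ℕ; _%_)
open import Data.Nat.Primality using (Prime)
open import Data.Integer as ℤ using (ℤ; +_; _+_; _-_; _*_; _≤_)
open import Data.Integer.GCD using (gcd)
open import Data.Rational as ℚ using (ℚ)
open import Data.Product using (Σ; ∃; ∃-syntax; _×_; _,_; proj₁; proj₂)
open import Data.List using (List)
open import Data.Nat.ListAction using (product)
open import Data.List.Relation.Unary.All using (All)
open import Data.Fin using (Fin)
open import Relation.Binary.PropositionalEquality using (_≡_; _≢_)
open import Relation.Nullary using (¬_)

-- An element r + s ω of ℤ[ω], ω = e^{2πi/3}, represented by its
-- coordinates (r , s) in the basis (1 , ω) of ℝ² ≅ ℂ.
Eis : Set
Eis = ℤ × ℤ

re im : Eis → ℤ
re = proj₁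
im = proj₂

0E 1E ωE : Eis
0E = (+ 0 , + 0)
1E = (+ 1 , + 0)
ωE = (+ 0 , + 1)

_⊕_ : Eis → Eis → Eis
(a , b) ⊕ (c , d) = (a + c , b + d)

_⊖_ : Eis → Eis → Eis
(a , b) ⊖ (c , d) = (a - c , b - d)

_·_ : ℤ → Eis → Eis
k · (a , b) = (k * a , k * b)

-- multiplication in ℤ[ω], using ω² = -1 - ω
_⊗_ : Eis → Eis → Eis
(a , b) ⊗ (c , d) = (a * c - b * d , (a * d + b * c) - b * d)

-- θ = ω - ω̄ = ω - ω² = 1 + 2ω = √-3
θ : Eis
θ = (+ 1 , + 2)

-- twice the Euclidean inner product of ℝ² on points of ℤ[ω]:
-- 2 (u · v) for u = a + bω, v = c + dω (using 1·1 = ω·ω = 1, 1·ω = -1/2)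
dot2 : Eis → Eis → ℤ
dot2 (a , b) (c , d) = ((+ 2 * a * c - a * d) - b * c) + + 2 * b * d

normSq : Eis → ℤ
normSq (a , b) = (a * a - a * b) + b * b

Primitive : Eis → Set
Primitive (r , s) = gcd r s ≡ + 1

Sub : Set₁
Sub = Eis → Set

InVoronoiCell : Sub → Eis → Eis → Set
InVoronoiCell L' p x = ∀ r → L' r → normSq (x ⊖ p) ≤ normSq (x ⊖ r)

OnVoronoiBoundary : Sub → Eis → Eis → Set
OnVoronoiBoundary L' p x =
  InVoronoiCell L' p x × ∃[ q ] (L' q × q ≢ p × InVoronoiCell L' q x)

Clean : Sub → Set
Clean L' = ∀ p x → L' p → ¬ OnVoronoiBoundary L' p x

mulLattice : Eis → Sub
mulLattice α y = ∃[ β ] (α ⊗ β ≡ y)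

-- A linear map σ : ℝ² → ℝ² with σ(Λ) ⊆ Λ is determined by σ(1), σ(ω) ∈ Λ.
LinMap : Set
LinMap = Eis × Eis

apply : LinMap → Eis → Eis
apply (s1 , sω) (u , v) = (u · s1) ⊕ (v · sω)

image : LinMap → Sub
image σ y = ∃[ β ] (apply σ β ≡ y)

toℚ : ℤ → ℚ
toℚ n = n ℚ./ 1

-- σ u · σ v = c (u · v) for some real c > 0 (c is necessarily rational)
IsSimilarity : LinMap → Set
IsSimilarity σ = ∃[ c ] (ℚ.0ℚ ℚ.< c ×
  (∀ u v → toℚ (dot2 (apply σ u) (apply σ v)) ≡ c ℚ.* toℚ (dot2 u v)))

Congruent : Sub → Eis → Eis → Set
Congruent L' y z = L' (y ⊖ z)

HasIndex : Sub → ℕ → Set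
HasIndex L' n = Σ (Fin n → Eis) λ rep → (
  (∀ (i j : Fin n) → Congruent L' (rep i) (rep j) → i ≡ j) ×
  (∀ x → ∃[ i ] Congruent L' x (rep i)))

-- n is a (possibly empty) product of primes ≡ 1 (mod 3)
ProductOfPrimes1mod3 : ℕ → Set
ProductOfPrimes1mod3 n =
  Σ (List ℕ) λ ps → (All (λ p → Prime p × p % 3 ≡ 1) ps × product ps ≡ n)

{-# OPTIONS --safe #-}
-- The Voronoi cell of 0 in αΛ is α times the regular hexagon V of Λ: writing w = (x − α s) ᾱ for x seen
-- from the lattice point α s, x lies in that cell iff dot2 w γ ≤ N(α) N(γ) for all γ, and it lies on the
-- boundary iff moreover dot2 w ε = N(α) for one of the six units ε. After a rotation by ε, a lattice point
-- y on the edge facing α satisfies 2 y ᾱ = N(α) + s θ with ∣3s∣ ≤ N(α), i.e. N(α) (2y − α) = s α θ. If α θ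
-- is primitive this forces N(α) ∣ s, so s = 0 and 2 ∣ α θ, which is absurd. Conversely, a prime q dividing
-- α θ yields a lattice point on the boundary: α ω / θ, a vertex of the cell, when q = 3, and a point of the
-- edge facing α when q ∣ α.
--
-- A similarity of Λ sends ω to σ(1) ω or σ(1) ω̄, so its image is αΛ with α = σ(1), of index N(α) when α
-- is primitive. Moreover α θ is primitive iff α is primitive and 3 ∤ N(α). For such α every prime
-- factor of N(α) is itself a norm (Fermat descent), hence 3 or ≡ 1 (mod 3). Conversely a prime p ≡ 1
-- (mod 3) is a norm: r ↦ (r − 1)/r has order 3 on {2, …, p − 1}, and 3 ∤ p − 2 forces a fixed point,
-- a root of r² − r + 1; multiplying a primitive α of norm n by π or π̄ of norm p keeps it primitive.

module Submission where

open import Defs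
open import Data.Bool using (if_then_else_; _∧_)
import Data.Bool.Properties as Bool
open import Data.Empty using (⊥; ⊥-elim)
open import Data.Fin using (Fin; toℕ; fromℕ<)
open import Data.Fin.Patterns using (0F; 1F; 2F; 3F; 4F; 5F)
open import Data.Fin.Permutation using (Permutation; permutation)
import Data.Fin.Properties as Fin
open import Data.Integer as ℤ using (ℤ; +_; +[1+_]; -[1+_]; _+_; _-_; _*_; -_; _≤_; 0ℤ; 1ℤ; -1ℤ)
open import Data.Integer.DivMod using (_%ℕ_; _/ℕ_; a≡a%ℕn+[a/ℕn]*n; n%ℕd<d)
open import Data.Integer.Divisibility.Signed
  using (_∣_; _∣?_; divides; ∣ᵤ⇒∣; ∣⇒∣ᵤ; ∣-refl; ∣m∣n⇒∣m+n; ∣m∣n⇒∣m-n; ∣m⇒∣-m; ∣n⇒∣m*n; ∣m⇒∣m*n)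
open import Data.Integer.GCD using (gcd; gcd[i,j]∣i; gcd[i,j]∣j; gcd[i,j]≡0⇒i≡0; gcd[i,j]≡0⇒j≡0)
import Data.Integer.Properties as ℤ
open import Data.Integer.Solver using (module +-*-Solver)
open import Data.Integer.Tactic.RingSolver using (solve-∀; solve)
open import Data.List using ([]; _∷_)
open import Data.List.Relation.Unary.All as All using (All)
open import Data.Nat as ℕ using (ℕ; zero; suc; _%_; _<_; _<?_)
open import Data.Nat.Coprimality using (coprime-Bézout; gcd≡1⇒coprime)
import Data.Nat.Coprimality as ℕ
import Data.Nat.DivMod as ℕ
import Data.Nat.Divisibility as ℕ
open import Data.Nat.GCD using (module Bézout)
import Data.Nat.GCD as ℕ
open import Data.Nat.Induction using (<-wellFounded)
open import Data.Nat.ListAction using (product)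
open import Data.Nat.Primality
  using (Prime; prime?; prime[2]; prime⇒irreducible; prime⇒nonTrivial; prime⇒nonZero; euclidsLemma; ¬prime[0]; ¬prime[1])
open import Data.Nat.Primality.Factorisation using (factorise; PrimeFactorisation)
import Data.Nat.Properties as ℕ
open import Algebra.Properties.CommutativeMonoid.Sum ℕ.+-0-commutativeMonoid using (sum; sum-permute; ∑-distrib-+; sum-cong-≗)
open import Data.Product using (∃; ∃₂; ∃-syntax; _×_; _,_; proj₁; proj₂)
open import Data.Rational as ℚ using (mkℚ; ↥_; ↧_)
import Data.Rational.Properties as ℚ
import Data.Rational.Unnormalised as ℚᵘ
import Data.Rational.Unnormalised.Properties as ℚᵘ
import Data.Sum as Sum
open Sum using (_⊎_; inj₁; inj₂; [_,_]′)
open import Function using (id; _∘_)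
open import Function.Bundles using (_⇔_; mk⇔; Equivalence)
open import Induction.WellFounded using (Acc; acc)
open import Relation.Binary.Definitions using (tri<; tri≈; tri>)
open import Relation.Binary.PropositionalEquality
open import Relation.Nullary using (¬_; Dec; yes; no; does; contradiction)
open import Relation.Nullary.Decidable using (decidable-stable; from-yes; dec-true; dec-false)
open import Relation.Unary using (_≐_)
open import Relation.Unary.Properties using (≐-sym)

-- Arithmetic of ℤ[ω]

conj : Eis → Eis
conj (a , b) = (a - b , - b)

-- The six units ζᵏ of ℤ[ω], where ζ = 1 + ω = -ω² is a primitive sixth root of unity.
unit : Fin 6 → Eis
unit 0F = (1ℤ , 0ℤ)
unit 1F = (1ℤ , 1ℤ)
unit 2F = (0ℤ , 1ℤ)
unit 3F = (-1ℤ , 0ℤ)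
unit 4F = (-1ℤ , -1ℤ)
unit 5F = (0ℤ , -1ℤ)

-- The operations of ℤ[ω] on pairs of polynomials. Their semantics is definitionally the corresponding
-- operation on ℤ × ℤ, so the ring solver proves identities of ℤ[ω] coordinatewise (Poly.solve … refl).
module Poly = +-*-Solver
open Poly using (Polynomial; _:=_; _:+_; _:*_; _:-_; :-_; con)

Poly² : ℕ → Set
Poly² n = Polynomial n × Polynomial n

module _ {n : ℕ} where
  infixl 6 _⊕ᴾ_ _⊖ᴾ_
  infixl 7 _⊗ᴾ_ _·ᴾ_

  _⊕ᴾ_ _⊖ᴾ_ _⊗ᴾ_ : Poly² n → Poly² n → Poly² n
  (a , b) ⊕ᴾ (c , d) = (a :+ c , b :+ d)
  (a , b) ⊖ᴾ (c , d) = (a :- c , b :- d)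
  (a , b) ⊗ᴾ (c , d) = (a :* c :- b :* d , (a :* d :+ b :* c) :- b :* d)

  _·ᴾ_ : Polynomial n → Poly² n → Poly² n
  k ·ᴾ (a , b) = (k :* a , k :* b)

  conjᴾ : Poly² n → Poly² n
  conjᴾ (a , b) = (a :- b , :- b)

  normSqᴾ : Poly² n → Polynomial n
  normSqᴾ (a , b) = (a :* a :- a :* b) :+ b :* b

  dot2ᴾ : Poly² n → Poly² n → Polynomial n
  dot2ᴾ (a , b) (c , d) = ((con (+ 2) :* a :* c :- a :* d) :- b :* c) :+ con (+ 2) :* b :* d

  ⟨_⟩ᴾ : Eis → Poly² n
  ⟨ a , b ⟩ᴾ = (con a , con b)

normSq-⊗ : ∀ x y → normSq (x ⊗ y) ≡ normSq x * normSq y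
normSq-⊗ (a , b) (c , d) =
  Poly.solve 4 (λ a b c d → normSqᴾ ((a , b) ⊗ᴾ (c , d)) := normSqᴾ (a , b) :* normSqᴾ (c , d)) refl a b c d

normSq-conj : ∀ x → normSq (conj x) ≡ normSq x
normSq-conj (a , b) = Poly.solve 2 (λ a b → normSqᴾ (conjᴾ (a , b)) := normSqᴾ (a , b)) refl a b

normSq-· : ∀ k x → normSq (k · x) ≡ k * (k * normSq x)
normSq-· k (a , b) = Poly.solve 3 (λ k a b → normSqᴾ (k ·ᴾ (a , b)) := k :* (k :* normSqᴾ (a , b))) refl k a b

dot2-⊗-conj : ∀ y e z → dot2 (y ⊗ conj e) z ≡ dot2 y (z ⊗ e)
dot2-⊗-conj (a , b) (c , d) (e , f) = Poly.solve 6 (λ a b c d e f →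
  dot2ᴾ ((a , b) ⊗ᴾ conjᴾ (c , d)) (e , f) := dot2ᴾ (a , b) ((e , f) ⊗ᴾ (c , d))) refl a b c d e f

⊗-identityʳ : ∀ x → x ⊗ 1E ≡ x
⊗-identityʳ (a , b) = cong₂ _,_
  (Poly.solve 2 (λ a b → proj₁ ((a , b) ⊗ᴾ ⟨ 1E ⟩ᴾ) := a) refl a b)
  (Poly.solve 2 (λ a b → proj₂ ((a , b) ⊗ᴾ ⟨ 1E ⟩ᴾ) := b) refl a b)

⊗-zeroʳ : ∀ x → x ⊗ 0E ≡ 0E
⊗-zeroʳ (a , b) = cong₂ _,_
  (Poly.solve 2 (λ a b → proj₁ ((a , b) ⊗ᴾ ⟨ 0E ⟩ᴾ) := con 0ℤ) refl a b)
  (Poly.solve 2 (λ a b → proj₂ ((a , b) ⊗ᴾ ⟨ 0E ⟩ᴾ) := con 0ℤ) refl a b)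

conj-involutive : ∀ x → conj (conj x) ≡ x
conj-involutive (a , b) = cong₂ _,_
  (Poly.solve 2 (λ a b → proj₁ (conjᴾ (conjᴾ (a , b))) := a) refl a b)
  (Poly.solve 2 (λ a b → proj₂ (conjᴾ (conjᴾ (a , b))) := b) refl a b)

⊖≡0E⇒≡ : ∀ x y → x ⊖ y ≡ 0E → x ≡ y
⊖≡0E⇒≡ (a , b) (c , d) eq = cong₂ _,_ (ℤ.i-j≡0⇒i≡j a c (cong re eq)) (ℤ.i-j≡0⇒i≡j b d (cong im eq))

square-nonNeg : ∀ i → 0ℤ ≤ i * i
square-nonNeg (+ n) = subst (0ℤ ≤_) (ℤ.pos-* n n) (ℤ.+≤+ ℕ.z≤n)
square-nonNeg -[1+ n ] = ℤ.+≤+ ℕ.z≤n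

+-nonNeg : ∀ {i j} → 0ℤ ≤ i → 0ℤ ≤ j → 0ℤ ≤ i + j
+-nonNeg = ℤ.+-mono-≤

*-nonNeg : ∀ {i j} → 0ℤ ≤ i → 0ℤ ≤ j → 0ℤ ≤ i * j
*-nonNeg {+ m} {+ n} _ _ = subst (0ℤ ≤_) (ℤ.pos-* m n) (ℤ.+≤+ ℕ.z≤n)

+-nonNeg-≡0 : ∀ {i j} → 0ℤ ≤ i → 0ℤ ≤ j → i + j ≡ 0ℤ → i ≡ 0ℤ × j ≡ 0ℤ
+-nonNeg-≡0 {+ m} {+ n} _ _ eq with ℕ.m+n≡0⇒m≡0 m (ℤ.+-injective eq) | ℕ.m+n≡0⇒n≡0 m (ℤ.+-injective eq)
... | refl | refl = refl , refl

≤-by-difference : ∀ {i j d} → 0ℤ ≤ d → j - i ≡ d → i ≤ j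
≤-by-difference 0≤d j-i≡d = ℤ.0≤i-j⇒j≤i (subst (0ℤ ≤_) (sym j-i≡d) 0≤d)

square≡0 : ∀ {i} → i * i ≡ 0ℤ → i ≡ 0ℤ
square≡0 {i} eq with ℤ.i*j≡0⇒i≡0∨j≡0 i eq
... | inj₁ i≡0 = i≡0
... | inj₂ i≡0 = i≡0

four-normSq : ∀ a b → + 4 * normSq (a , b) ≡ (+ 2 * a - b) * (+ 2 * a - b) + + 3 * (b * b)
four-normSq a b = Poly.solve 2 (λ a b →
  con (+ 4) :* normSqᴾ (a , b) := (con (+ 2) :* a :- b) :* (con (+ 2) :* a :- b) :+ con (+ 3) :* (b :* b)) refl a b

private
  0≤3b² : ∀ b → 0ℤ ≤ + 3 * (b * b)
  0≤3b² b = *-nonNeg {+ 3} (ℤ.+≤+ ℕ.z≤n) (square-nonNeg b)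

  squares≡0 : ∀ a b → normSq (a , b) ≡ 0ℤ → (+ 2 * a - b) * (+ 2 * a - b) ≡ 0ℤ × + 3 * (b * b) ≡ 0ℤ
  squares≡0 a b N≡0 = +-nonNeg-≡0 (square-nonNeg (+ 2 * a - b)) (0≤3b² b)
    (trans (sym (four-normSq a b)) (cong (+ 4 *_) N≡0))

normSq-nonNeg : ∀ x → 0ℤ ≤ normSq x
normSq-nonNeg (a , b) = ℤ.*-cancelˡ-≤-pos 0ℤ (normSq (a , b)) (+ 4)
  (subst (0ℤ ≤_) (sym (four-normSq a b)) (+-nonNeg (square-nonNeg (+ 2 * a - b)) (0≤3b² b)))

normSq≡0⇒≡0E : ∀ x → normSq x ≡ 0ℤ → x ≡ 0E
normSq≡0⇒≡0E (a , b) N≡0 = cong₂ _,_ a≡0 b≡0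
  where
  b≡0 : b ≡ 0ℤ
  b≡0 = square≡0 (ℤ.*-cancelˡ-≡ (+ 3) (b * b) 0ℤ (proj₂ (squares≡0 a b N≡0)))
  2a-0≡0 : + 2 * a - 0ℤ ≡ 0ℤ
  2a-0≡0 = subst (λ c → + 2 * a - c ≡ 0ℤ) b≡0 (square≡0 (proj₁ (squares≡0 a b N≡0)))
  a≡0 : a ≡ 0ℤ
  a≡0 = ℤ.*-cancelˡ-≡ (+ 2) a 0ℤ (trans (sym (ℤ.+-identityʳ (+ 2 * a))) 2a-0≡0)

normSq-pos : ∀ {x} → x ≢ 0E → 0ℤ ℤ.< normSq x
normSq-pos {x} x≢0 = ℤ.≤∧≢⇒< (normSq-nonNeg x) (λ 0≡N → x≢0 (normSq≡0⇒≡0E x (sym 0≡N)))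

⊗-zero-divisor : ∀ x y → x ⊗ y ≡ 0E → x ≡ 0E ⊎ y ≡ 0E
⊗-zero-divisor x y xy≡0 =
  Sum.map (normSq≡0⇒≡0E x) (normSq≡0⇒≡0E y)
    (ℤ.i*j≡0⇒i≡0∨j≡0 (normSq x) {normSq y} (trans (sym (normSq-⊗ x y)) (cong normSq xy≡0)))

-- Primes and primitive elements

prime-divisor : ∀ n → n ≢ 0 → n ≢ 1 → ∃ λ p → Prime p × p ℕ.∣ n
prime-divisor zero n≢0 _ = ⊥-elim (n≢0 refl)
prime-divisor n@(suc _) _ n≢1 = first-factor (factors (factorise n)) (isFactorisation (factorise n)) (factorsPrime (factorise n))
  where
  open PrimeFactorisation
  first-factor : ∀ ps → n ≡ product ps → All Prime ps → ∃ λ p → Prime p × p ℕ.∣ n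
  first-factor [] n≡1 _ = ⊥-elim (n≢1 n≡1)
  first-factor (p ∷ ps) n≡p*_ (prime-p All.∷ _) = p , prime-p , ℕ.divides (product ps) (trans n≡p*_ (ℕ.*-comm p (product ps)))

prime∤1 : ∀ {p} → Prime p → ¬ (+ p ∣ 1ℤ)
prime∤1 prime-p p∣1 with ℕ.∣1⇒≡1 (∣⇒∣ᵤ p∣1)
... | refl = ¬prime[1] prime-p

prime[3] : Prime 3
prime[3] = from-yes (prime? 3)

prime-∣-prime : ∀ {p q} → Prime p → Prime q → (+ q) ∣ + p → q ≡ p
prime-∣-prime prime-p prime-q q∣p =
  [ (λ q≡1 → contradiction (subst Prime q≡1 prime-q) ¬prime[1]) , (λ q≡p → q≡p) ]′ (prime⇒irreducible prime-p (∣⇒∣ᵤ q∣p))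

prime-∣-* : ∀ {p} i j → Prime p → (+ p) ∣ i * j → ((+ p) ∣ i) ⊎ ((+ p) ∣ j)
prime-∣-* i j prime-p p∣ij =
  Sum.map ∣ᵤ⇒∣ ∣ᵤ⇒∣ (euclidsLemma (ℤ.∣ i ∣) (ℤ.∣ j ∣) prime-p (subst (_ ℕ.∣_) (ℤ.abs-* i j) (∣⇒∣ᵤ p∣ij)))

infix 4 _∣ᴱ_

_∣ᴱ_ : ℤ → Eis → Set
k ∣ᴱ x = k ∣ re x × k ∣ im x

∣ᴱ-⊗ʳ : ∀ {k} x y → k ∣ᴱ x → k ∣ᴱ x ⊗ y
∣ᴱ-⊗ʳ (a , b) (c , d) (k∣a , k∣b) =
  ∣m∣n⇒∣m-n (∣m⇒∣m*n c k∣a) (∣m⇒∣m*n d k∣b) ,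
  ∣m∣n⇒∣m-n (∣m∣n⇒∣m+n (∣m⇒∣m*n d k∣a) (∣m⇒∣m*n c k∣b)) (∣m⇒∣m*n d k∣b)

primitive? : ∀ x → Dec (Primitive x)
primitive? (r , s) = gcd r s ℤ.≟ + 1

private
  abs-as-multiple : ∀ i → ∃ λ σ → + ℤ.∣ i ∣ ≡ σ * i
  abs-as-multiple (+ n) = 1ℤ , sym (ℤ.*-identityˡ (+ n))
  abs-as-multiple -[1+ n ] = - 1ℤ , sym (ℤ.-1*i≡-i -[1+ n ])

  1+b≡a⇒a-b≡1 : ∀ {a b} → 1ℤ + b ≡ a → a - b ≡ 1ℤ
  1+b≡a⇒a-b≡1 {b = b} refl = solve (b ∷ [])

  bezout-from-ℕ : ∀ {x y m n} → 1 ℕ.+ y ℕ.* n ≡ x ℕ.* m → + x * + m - + y * + n ≡ 1ℤ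
  bezout-from-ℕ {x} {y} {m} {n} eq =
    subst₂ (λ A B → A - B ≡ 1ℤ) (ℤ.pos-* x m) (ℤ.pos-* y n) (1+b≡a⇒a-b≡1 {b = + (y ℕ.* n)} (cong +_ eq))

  regroup : ∀ X Y σ τ r s → X * σ * r + - (Y * τ) * s ≡ X * (σ * r) - Y * (τ * s)
  regroup = solve-∀

  regroup′ : ∀ X Y σ τ r s → - (X * σ) * r + Y * τ * s ≡ Y * (τ * s) - X * (σ * r)
  regroup′ = solve-∀

∣ᴱ-· : ∀ k x → k ∣ᴱ k · x
∣ᴱ-· k (r , s) = ∣m⇒∣m*n r ∣-refl , ∣m⇒∣m*n s ∣-refl

∣ᴱ⇒· : ∀ {k} x → k ∣ᴱ x → ∃ λ x′ → x ≡ k · x′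
∣ᴱ⇒· {k} (r , s) (divides r′ r≡ , divides s′ s≡) =
  (r′ , s′) , cong₂ _,_ (trans r≡ (ℤ.*-comm r′ k)) (trans s≡ (ℤ.*-comm s′ k))

∣ᴱ-conj : ∀ {k} x → k ∣ᴱ x → k ∣ᴱ conj x
∣ᴱ-conj (a , b) (k∣a , k∣b) = ∣m∣n⇒∣m-n k∣a k∣b , ∣m⇒∣-m k∣b

primitive-bezout : ∀ {r s} → Primitive (r , s) → ∃₂ λ u v → u * r + v * s ≡ 1ℤ
primitive-bezout {r} {s} prim with abs-as-multiple r | abs-as-multiple s | coprime-Bézout (gcd≡1⇒coprime (ℤ.+-injective prim))
... | σ , ∣r∣≡σr | τ , ∣s∣≡τs | Bézout.+- x y eq = + x * σ , - (+ y * τ) ,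
  trans (regroup (+ x) (+ y) σ τ r s)
        (subst₂ (λ R S → + x * R - + y * S ≡ 1ℤ) ∣r∣≡σr ∣s∣≡τs (bezout-from-ℕ {x} {y} {ℤ.∣ r ∣} {ℤ.∣ s ∣} eq))
... | σ , ∣r∣≡σr | τ , ∣s∣≡τs | Bézout.-+ x y eq = - (+ x * σ) , + y * τ ,
  trans (regroup′ (+ x) (+ y) σ τ r s)
        (subst₂ (λ R S → + y * S - + x * R ≡ 1ℤ) ∣r∣≡σr ∣s∣≡τs (bezout-from-ℕ {y} {x} {ℤ.∣ s ∣} {ℤ.∣ r ∣} eq))

primitive-∣ᴱ-· : ∀ {k t x} → Primitive x → k ∣ᴱ t · x → k ∣ t
primitive-∣ᴱ-· {k} {t} {r , s} prim (k∣tr , k∣ts) with primitive-bezout prim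
... | u , v , bezout = subst (k ∣_) combination (∣m∣n⇒∣m+n (∣n⇒∣m*n u k∣tr) (∣n⇒∣m*n v k∣ts))
  where
  combination : u * (t * r) + v * (t * s) ≡ t
  combination = begin
    u * (t * r) + v * (t * s) ≡⟨ solve (u ∷ v ∷ t ∷ r ∷ s ∷ []) ⟩
    t * (u * r + v * s)       ≡⟨ cong (t *_) bezout ⟩
    t * 1ℤ                    ≡⟨ ℤ.*-identityʳ t ⟩
    t                         ∎
    where open ≡-Reasoning

primitive⇒prime∤ᴱ : ∀ {p x} → Primitive x → Prime p → ¬ (+ p ∣ᴱ x)
primitive⇒prime∤ᴱ prim prime-p (p∣r , p∣s) = prime∤1 prime-p (primitive-∣ᴱ-· prim (∣n⇒∣m*n 1ℤ p∣r , ∣n⇒∣m*n 1ℤ p∣s))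

¬primitive⇒prime-∣ᴱ : ∀ x → x ≢ 0E → ¬ Primitive x → ∃ λ p → Prime p × + p ∣ᴱ x
¬primitive⇒prime-∣ᴱ (r , s) x≢0 ¬prim with prime-divisor (ℕ.gcd ℤ.∣ r ∣ ℤ.∣ s ∣) g≢0 (λ g≡1 → ¬prim (cong +_ g≡1))
  where
  g≢0 : ℕ.gcd ℤ.∣ r ∣ ℤ.∣ s ∣ ≢ 0
  g≢0 g≡0 = x≢0 (cong₂ _,_ (gcd[i,j]≡0⇒i≡0 r s (cong +_ g≡0)) (gcd[i,j]≡0⇒j≡0 {r} (cong +_ g≡0)))
... | p , prime-p , p∣g = p , prime-p , ∣ᵤ⇒∣ (ℕ.∣-trans p∣g (gcd[i,j]∣i r s)) , ∣ᵤ⇒∣ (ℕ.∣-trans p∣g (gcd[i,j]∣j r s))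

primitive⇒≢0E : ∀ {x} → Primitive x → x ≢ 0E
primitive⇒≢0E prim refl = contradiction prim λ ()

primitive-by-primes : ∀ x → x ≢ 0E → (∀ {p} → Prime p → ¬ (+ p ∣ᴱ x)) → Primitive x
primitive-by-primes x x≢0 no-prime = decidable-stable (primitive? x) λ ¬prim →
  let (p , prime-p , p∣x) = ¬primitive⇒prime-∣ᴱ x x≢0 ¬prim in no-prime prime-p p∣x

primitive-⊗ˡ : ∀ x y → Primitive (x ⊗ y) → Primitive x
primitive-⊗ˡ x y prim = primitive-by-primes x (primitive⇒≢0E prim ∘ cong (_⊗ y))
  (λ prime-p p∣x → primitive⇒prime∤ᴱ prim prime-p (∣ᴱ-⊗ʳ x y p∣x))

primitive-conj : ∀ x → Primitive x → Primitive (conj x)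
primitive-conj x prim = primitive-by-primes (conj x) conj-x≢0
  (λ prime-p p∣x̄ → primitive⇒prime∤ᴱ prim prime-p (subst (_ ∣ᴱ_) (conj-involutive x) (∣ᴱ-conj (conj x) p∣x̄)))
  where
  conj-x≢0 : conj x ≢ 0E
  conj-x≢0 x̄≡0 = primitive⇒≢0E prim (trans (sym (conj-involutive x)) (cong conj x̄≡0))

-- The hexagonal Voronoi cell of Λ

-- w lies in N·V, where V is the Voronoi cell of 0 in Λ, a regular hexagon.
InHexagon : ℤ → Eis → Set
InHexagon N w = ∀ γ → dot2 w γ ≤ N * normSq γ

normSq-unit : ∀ k → normSq (unit k) ≡ 1ℤ
normSq-unit 0F = refl
normSq-unit 1F = refl
normSq-unit 2F = refl
normSq-unit 3F = refl
normSq-unit 4F = refl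
normSq-unit 5F = refl

unit-⊗ζ : ∀ k → ∃ λ k′ → unit k ⊗ unit 1F ≡ unit k′
unit-⊗ζ 0F = 1F , refl
unit-⊗ζ 1F = 2F , refl
unit-⊗ζ 2F = 3F , refl
unit-⊗ζ 3F = 4F , refl
unit-⊗ζ 4F = 5F , refl
unit-⊗ζ 5F = 0F , refl

private
  0≤-i : ∀ {i} → ¬ (0ℤ ≤ i) → 0ℤ ≤ - i
  0≤-i 0≰i = ℤ.neg-mono-≤ (ℤ.<⇒≤ (ℤ.≰⇒> 0≰i))

  0≤j-i : ∀ {i j} → ¬ (j ≤ i) → 0ℤ ≤ j - i
  0≤j-i j≰i = ℤ.i≤j⇒0≤j-i (ℤ.<⇒≤ (ℤ.≰⇒> j≰i))

fundamental-sector : ∀ γ → ∃ λ k → ∃₂ λ a b → 0ℤ ≤ a × 0ℤ ≤ b × γ ≡ unit k ⊗ (a + b , b)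
fundamental-sector (u , v) = sector (0ℤ ℤ.≤? u) (0ℤ ℤ.≤? v) (v ℤ.≤? u)
  where
  sector : Dec (0ℤ ≤ u) → Dec (0ℤ ≤ v) → Dec (v ≤ u) →
           ∃ λ k → ∃₂ λ a b → 0ℤ ≤ a × 0ℤ ≤ b × (u , v) ≡ unit k ⊗ (a + b , b)
  sector (yes 0≤u) (yes 0≤v) (yes v≤u) = 0F , u - v , v , ℤ.i≤j⇒0≤j-i v≤u , 0≤v ,
    cong₂ _,_ (Poly.solve 2 (λ u v → u := proj₁ (⟨ unit 0F ⟩ᴾ ⊗ᴾ ((u :- v) :+ v , v))) refl u v)
              (Poly.solve 2 (λ u v → v := proj₂ (⟨ unit 0F ⟩ᴾ ⊗ᴾ ((u :- v) :+ v , v))) refl u v)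
  sector (yes 0≤u) (yes 0≤v) (no v≰u) = 1F , u , v - u , 0≤u , 0≤j-i v≰u ,
    cong₂ _,_ (Poly.solve 2 (λ u v → u := proj₁ (⟨ unit 1F ⟩ᴾ ⊗ᴾ (u :+ (v :- u) , v :- u))) refl u v)
              (Poly.solve 2 (λ u v → v := proj₂ (⟨ unit 1F ⟩ᴾ ⊗ᴾ (u :+ (v :- u) , v :- u))) refl u v)
  sector (no 0≰u) (yes 0≤v) _ = 2F , v , - u , 0≤v , 0≤-i 0≰u ,
    cong₂ _,_ (Poly.solve 2 (λ u v → u := proj₁ (⟨ unit 2F ⟩ᴾ ⊗ᴾ (v :+ :- u , :- u))) refl u v)
              (Poly.solve 2 (λ u v → v := proj₂ (⟨ unit 2F ⟩ᴾ ⊗ᴾ (v :+ :- u , :- u))) refl u v)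
  sector (no 0≰u) (no 0≰v) (no v≰u) = 3F , v - u , - v , 0≤j-i v≰u , 0≤-i 0≰v ,
    cong₂ _,_ (Poly.solve 2 (λ u v → u := proj₁ (⟨ unit 3F ⟩ᴾ ⊗ᴾ ((v :- u) :+ :- v , :- v))) refl u v)
              (Poly.solve 2 (λ u v → v := proj₂ (⟨ unit 3F ⟩ᴾ ⊗ᴾ ((v :- u) :+ :- v , :- v))) refl u v)
  sector (no 0≰u) (no 0≰v) (yes v≤u) = 4F , - u , u - v , 0≤-i 0≰u , ℤ.i≤j⇒0≤j-i v≤u ,
    cong₂ _,_ (Poly.solve 2 (λ u v → u := proj₁ (⟨ unit 4F ⟩ᴾ ⊗ᴾ (:- u :+ (u :- v) , u :- v))) refl u v)
              (Poly.solve 2 (λ u v → v := proj₂ (⟨ unit 4F ⟩ᴾ ⊗ᴾ (:- u :+ (u :- v) , u :- v))) refl u v)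
  sector (yes 0≤u) (no 0≰v) _ = 5F , - v , u , 0≤-i 0≰v , 0≤u ,
    cong₂ _,_ (Poly.solve 2 (λ u v → u := proj₁ (⟨ unit 5F ⟩ᴾ ⊗ᴾ (:- v :+ u , u))) refl u v)
              (Poly.solve 2 (λ u v → v := proj₂ (⟨ unit 5F ⟩ᴾ ⊗ᴾ (:- v :+ u , u))) refl u v)

private
  0≤i*i-i : ∀ {i} → 0ℤ ≤ i → 0ℤ ≤ i * i - i
  0≤i*i-i {+ zero} _ = ℤ.+≤+ ℕ.z≤n
  0≤i*i-i {+ suc n} _ = subst (0ℤ ≤_) (i*i-i (+ n)) (*-nonNeg {+ suc n} (ℤ.+≤+ ℕ.z≤n) (ℤ.+≤+ ℕ.z≤n))
    where
    i*i-i : ∀ k → (1ℤ + k) * k ≡ (1ℤ + k) * (1ℤ + k) - (1ℤ + k)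
    i*i-i = solve-∀

  sector-slack : ∀ N a b X Y → N * (a * a + a * b + b * b) - (a * X + b * Y)
                 ≡ (a * (N - X) + b * (N - Y)) + N * ((a * a - a) + (b * b - b) + a * b)
  sector-slack = solve-∀

  module _ {N a b X Y : ℤ} (0≤N : 0ℤ ≤ N) (0≤a : 0ℤ ≤ a) (0≤b : 0ℤ ≤ b) (X≤N : X ≤ N) (Y≤N : Y ≤ N) where
    0≤a[N-X] : 0ℤ ≤ a * (N - X)
    0≤a[N-X] = *-nonNeg 0≤a (ℤ.i≤j⇒0≤j-i X≤N)

    0≤b[N-Y] : 0ℤ ≤ b * (N - Y)
    0≤b[N-Y] = *-nonNeg 0≤b (ℤ.i≤j⇒0≤j-i Y≤N)

    0≤N[quadratic] : 0ℤ ≤ N * ((a * a - a) + (b * b - b) + a * b)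
    0≤N[quadratic] = *-nonNeg 0≤N (+-nonNeg (+-nonNeg (0≤i*i-i 0≤a) (0≤i*i-i 0≤b)) (*-nonNeg 0≤a 0≤b))

    sector-bound : a * X + b * Y ≤ N * (a * a + a * b + b * b)
    sector-bound = ℤ.0≤i-j⇒j≤i (subst (0ℤ ≤_) (sym (sector-slack N a b X Y))
      (+-nonNeg (+-nonNeg 0≤a[N-X] 0≤b[N-Y]) 0≤N[quadratic]))

    sector-tight : a * X + b * Y ≡ N * (a * a + a * b + b * b) → ¬ (a ≡ 0ℤ × b ≡ 0ℤ) → X ≡ N ⊎ Y ≡ N
    sector-tight tight nonzero =
      conclude (ℤ.i*j≡0⇒i≡0∨j≡0 a {N - X} a[N-X]≡0) (ℤ.i*j≡0⇒i≡0∨j≡0 b {N - Y} b[N-Y]≡0)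
      where
      slack≡0 : (a * (N - X) + b * (N - Y)) + N * ((a * a - a) + (b * b - b) + a * b) ≡ 0ℤ
      slack≡0 = trans (sym (sector-slack N a b X Y)) (ℤ.i≡j⇒i-j≡0 (sym tight))
      linear≡0 : a * (N - X) + b * (N - Y) ≡ 0ℤ
      linear≡0 = proj₁ (+-nonNeg-≡0 (+-nonNeg 0≤a[N-X] 0≤b[N-Y]) 0≤N[quadratic] slack≡0)
      a[N-X]≡0 : a * (N - X) ≡ 0ℤ
      a[N-X]≡0 = proj₁ (+-nonNeg-≡0 0≤a[N-X] 0≤b[N-Y] linear≡0)
      b[N-Y]≡0 : b * (N - Y) ≡ 0ℤ
      b[N-Y]≡0 = proj₂ (+-nonNeg-≡0 0≤a[N-X] 0≤b[N-Y] linear≡0)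
      conclude : a ≡ 0ℤ ⊎ N - X ≡ 0ℤ → b ≡ 0ℤ ⊎ N - Y ≡ 0ℤ → X ≡ N ⊎ Y ≡ N
      conclude (inj₂ N-X≡0) _ = inj₁ (sym (ℤ.i-j≡0⇒i≡j N X N-X≡0))
      conclude (inj₁ _) (inj₂ N-Y≡0) = inj₂ (sym (ℤ.i-j≡0⇒i≡j N Y N-Y≡0))
      conclude (inj₁ a≡0) (inj₁ b≡0) = contradiction (a≡0 , b≡0) nonzero

hexagon-unit : ∀ {N w} → InHexagon N w → ∀ k → dot2 w (unit k) ≤ N
hexagon-unit {N} {w} hex k =
  subst (dot2 w (unit k) ≤_) (trans (cong (N *_) (normSq-unit k)) (ℤ.*-identityʳ N)) (hex (unit k))

private
  dot2-sector : ∀ w e a b → dot2 w (e ⊗ (a + b , b)) ≡ a * dot2 w e + b * dot2 w (e ⊗ unit 1F)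
  dot2-sector (w₁ , w₂) (e₁ , e₂) a b = Poly.solve 6 (λ w₁ w₂ e₁ e₂ a b →
    dot2ᴾ (w₁ , w₂) ((e₁ , e₂) ⊗ᴾ (a :+ b , b)) := a :* dot2ᴾ (w₁ , w₂) (e₁ , e₂) :+ b :* dot2ᴾ (w₁ , w₂) ((e₁ , e₂) ⊗ᴾ ⟨ unit 1F ⟩ᴾ))
    refl w₁ w₂ e₁ e₂ a b

  dot2-unit-sector : ∀ w k a b → ∃ λ k′ → dot2 w (unit k ⊗ (a + b , b)) ≡ a * dot2 w (unit k) + b * dot2 w (unit k′)
  dot2-unit-sector w k a b =
    let (k′ , ζᵏ⁺¹) = unit-⊗ζ k
    in k′ , trans (dot2-sector w (unit k) a b) (cong (λ e → a * dot2 w (unit k) + b * dot2 w e) ζᵏ⁺¹)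

  normSq-unit-sector : ∀ k a b → normSq (unit k ⊗ (a + b , b)) ≡ a * a + a * b + b * b
  normSq-unit-sector k a b = begin
    normSq (unit k ⊗ (a + b , b))        ≡⟨ normSq-⊗ (unit k) (a + b , b) ⟩
    normSq (unit k) * normSq (a + b , b) ≡⟨ cong (_* normSq (a + b , b)) (normSq-unit k) ⟩
    1ℤ * normSq (a + b , b)              ≡⟨ Poly.solve 2 (λ a b → con 1ℤ :* normSqᴾ (a :+ b , b) := a :* a :+ a :* b :+ b :* b) refl a b ⟩
    a * a + a * b + b * b                ∎
    where open ≡-Reasoning

hexagon-from-units : ∀ {N w} → 0ℤ ≤ N → (∀ k → dot2 w (unit k) ≤ N) → InHexagon N w
hexagon-from-units {N} {w} 0≤N unit-bound γ =
  let (k , a , b , 0≤a , 0≤b , γ≡) = fundamental-sector γ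
      (k′ , dot≡) = dot2-unit-sector w k a b
  in subst (λ γ → dot2 w γ ≤ N * normSq γ) (sym γ≡)
       (subst₂ (λ D Q → D ≤ N * Q) (sym dot≡) (sym (normSq-unit-sector k a b))
         (sector-bound 0≤N 0≤a 0≤b (unit-bound k) (unit-bound k′)))

hexagon-face : ∀ {N w γ} → 0ℤ ≤ N → InHexagon N w → γ ≢ 0E → dot2 w γ ≡ N * normSq γ →
               ∃ λ k → dot2 w (unit k) ≡ N
hexagon-face {N} {w} {γ} 0≤N hex γ≢0 tight = face (fundamental-sector γ)
  where
  face : (∃ λ k → ∃₂ λ a b → 0ℤ ≤ a × 0ℤ ≤ b × γ ≡ unit k ⊗ (a + b , b)) → ∃ λ k → dot2 w (unit k) ≡ N
  face (k , a , b , 0≤a , 0≤b , γ≡) =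
    Sum.[ (k ,_) , (k′ ,_) ]′ (sector-tight 0≤N 0≤a 0≤b (hexagon-unit {N} {w} hex k) (hexagon-unit {N} {w} hex k′) tight′ nonzero)
    where
    k′ = proj₁ (dot2-unit-sector w k a b)
    tight′ : a * dot2 w (unit k) + b * dot2 w (unit k′) ≡ N * (a * a + a * b + b * b)
    tight′ = begin
      a * dot2 w (unit k) + b * dot2 w (unit k′) ≡⟨ sym (proj₂ (dot2-unit-sector w k a b)) ⟩
      dot2 w (unit k ⊗ (a + b , b))              ≡⟨ cong (dot2 w) (sym γ≡) ⟩
      dot2 w γ                                   ≡⟨ tight ⟩
      N * normSq γ                               ≡⟨ cong (λ γ → N * normSq γ) γ≡ ⟩
      N * normSq (unit k ⊗ (a + b , b))          ≡⟨ cong (N *_) (normSq-unit-sector k a b) ⟩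
      N * (a * a + a * b + b * b)                ∎
      where open ≡-Reasoning
    nonzero : ¬ (a ≡ 0ℤ × b ≡ 0ℤ)
    nonzero (refl , refl) = γ≢0 (trans γ≡ (⊗-zeroʳ (unit k)))

hexagon-rotate : ∀ {N w e} → normSq e ≡ 1ℤ → InHexagon N w → InHexagon N (w ⊗ conj e)
hexagon-rotate {N} {w} {e} Ne≡1 hex γ = begin
  dot2 (w ⊗ conj e) γ ≡⟨ dot2-⊗-conj w e γ ⟩
  dot2 w (γ ⊗ e)      ≤⟨ hex (γ ⊗ e) ⟩
  N * normSq (γ ⊗ e)  ≡⟨ cong (N *_) (trans (normSq-⊗ γ e) (trans (cong (normSq γ *_) Ne≡1) (ℤ.*-identityʳ (normSq γ)))) ⟩
  N * normSq γ        ∎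
  where open ℤ.≤-Reasoning

-- Voronoi cells of αΛ

private
  voronoi-identity : ∀ x α s β →
    normSq (x ⊖ (α ⊗ β)) - normSq (x ⊖ (α ⊗ s)) ≡
    normSq α * normSq (β ⊖ s) - dot2 ((x ⊖ (α ⊗ s)) ⊗ conj α) (β ⊖ s)
  voronoi-identity (x₁ , x₂) (a , b) (s₁ , s₂) (β₁ , β₂) = Poly.solve 8 (λ x₁ x₂ a b s₁ s₂ β₁ β₂ →
    let x = (x₁ , x₂); α = (a , b); s = (s₁ , s₂); β = (β₁ , β₂) in
    normSqᴾ (x ⊖ᴾ α ⊗ᴾ β) :- normSqᴾ (x ⊖ᴾ α ⊗ᴾ s) := normSqᴾ α :* normSqᴾ (β ⊖ᴾ s) :- dot2ᴾ ((x ⊖ᴾ α ⊗ᴾ s) ⊗ᴾ conjᴾ α) (β ⊖ᴾ s))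
    refl x₁ x₂ a b s₁ s₂ β₁ β₂

  ⊕-⊖-cancelˡ : ∀ s γ → (s ⊕ γ) ⊖ s ≡ γ
  ⊕-⊖-cancelˡ (s₁ , s₂) (γ₁ , γ₂) = cong₂ _,_
    (Poly.solve 4 (λ s₁ s₂ γ₁ γ₂ → proj₁ (((s₁ , s₂) ⊕ᴾ (γ₁ , γ₂)) ⊖ᴾ (s₁ , s₂)) := γ₁) refl s₁ s₂ γ₁ γ₂)
    (Poly.solve 4 (λ s₁ s₂ γ₁ γ₂ → proj₂ (((s₁ , s₂) ⊕ᴾ (γ₁ , γ₂)) ⊖ᴾ (s₁ , s₂)) := γ₂) refl s₁ s₂ γ₁ γ₂)

voronoi-cell⇔hexagon : ∀ α s x →
  InVoronoiCell (mulLattice α) (α ⊗ s) x ⇔ InHexagon (normSq α) ((x ⊖ (α ⊗ s)) ⊗ conj α)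
voronoi-cell⇔hexagon α s x = mk⇔ to from
  where
  w = (x ⊖ (α ⊗ s)) ⊗ conj α
  to : InVoronoiCell (mulLattice α) (α ⊗ s) x → InHexagon (normSq α) w
  to cell γ = subst (λ δ → dot2 w δ ≤ normSq α * normSq δ) (⊕-⊖-cancelˡ s γ)
    (ℤ.0≤i-j⇒j≤i (subst (0ℤ ≤_) (voronoi-identity x α s (s ⊕ γ))
      (ℤ.i≤j⇒0≤j-i (cell (α ⊗ (s ⊕ γ)) (s ⊕ γ , refl)))))
  from : InHexagon (normSq α) w → InVoronoiCell (mulLattice α) (α ⊗ s) x
  from hex _ (β , refl) = ≤-by-difference (ℤ.i≤j⇒0≤j-i (hex (β ⊖ s))) (voronoi-identity x α s β)

equidistant⇔tight : ∀ α s β x →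
  normSq (x ⊖ (α ⊗ β)) ≡ normSq (x ⊖ (α ⊗ s)) ⇔
  dot2 ((x ⊖ (α ⊗ s)) ⊗ conj α) (β ⊖ s) ≡ normSq α * normSq (β ⊖ s)
equidistant⇔tight α s β x = mk⇔
  (λ eq → sym (ℤ.i-j≡0⇒i≡j _ _ (trans (sym (voronoi-identity x α s β)) (ℤ.i≡j⇒i-j≡0 eq))))
  (λ tight → ℤ.i-j≡0⇒i≡j _ _ (trans (voronoi-identity x α s β) (ℤ.i≡j⇒i-j≡0 (sym tight))))

cell-of-equidistant : ∀ {L p q x} → InVoronoiCell L p x → normSq (x ⊖ q) ≡ normSq (x ⊖ p) → InVoronoiCell L q x
cell-of-equidistant {L} {p} {q} {x} cell eq r r∈L = subst (_≤ normSq (x ⊖ r)) (sym eq) (cell r r∈L)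

private
  3*i-bounded⇒i≡0 : ∀ {i} → -1ℤ ≤ + 3 * i → + 3 * i ≤ 1ℤ → i ≡ 0ℤ
  3*i-bounded⇒i≡0 {+ zero} _ _ = refl
  3*i-bounded⇒i≡0 {+[1+ n ]} _ (ℤ.+≤+ (ℕ.s≤s 3n+2≤0)) = contradiction (ℕ.m+n≤o⇒n≤o n 3n+2≤0) λ ()
  3*i-bounded⇒i≡0 { -[1+ n ]} (ℤ.-≤- 3n+2≤0) _ = contradiction (ℕ.m+n≤o⇒n≤o n 3n+2≤0) λ ()

small-multiple≡0 : ∀ {N s} → 0ℤ ℤ.< N → N ∣ s → - N ≤ + 3 * s → + 3 * s ≤ N → s ≡ 0ℤ
small-multiple≡0 {N} 0<N (divides k refl) -N≤3s 3s≤N = cong (_* N) k≡0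
  where
  instance
    _ = ℤ.positive 0<N
  3s≡N*3k : + 3 * (k * N) ≡ N * (+ 3 * k)
  3s≡N*3k = solve (k ∷ N ∷ [])
  -N≡N*-1 : - N ≡ N * -1ℤ
  -N≡N*-1 = solve (N ∷ [])
  k≡0 : k ≡ 0ℤ
  k≡0 = 3*i-bounded⇒i≡0
    (ℤ.*-cancelˡ-≤-pos -1ℤ (+ 3 * k) N (subst₂ _≤_ -N≡N*-1 3s≡N*3k -N≤3s))
    (ℤ.*-cancelˡ-≤-pos (+ 3 * k) 1ℤ N (subst₂ _≤_ 3s≡N*3k (sym (ℤ.*-identityʳ N)) 3s≤N))

private
  -- 2 y ᾱ = A + s θ with A = dot2 (y ᾱ) 1 and s = im (y ᾱ); multiply by α.
  edge-identity : ∀ y α → normSq α · (((+ 2) · y) ⊖ α) ≡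
    (im (y ⊗ conj α) · (α ⊗ θ)) ⊕ ((dot2 (y ⊗ conj α) 1E - normSq α) · α)
  edge-identity (y₁ , y₂) (a , b) = cong₂ _,_
    (Poly.solve 4 (λ y₁ y₂ a b → let y = (y₁ , y₂); α = (a , b); w = y ⊗ᴾ conjᴾ α in
      proj₁ (normSqᴾ α ·ᴾ (con (+ 2) ·ᴾ y ⊖ᴾ α)) := proj₁ (proj₂ w ·ᴾ (α ⊗ᴾ ⟨ θ ⟩ᴾ) ⊕ᴾ (dot2ᴾ w ⟨ 1E ⟩ᴾ :- normSqᴾ α) ·ᴾ α))
      refl y₁ y₂ a b)
    (Poly.solve 4 (λ y₁ y₂ a b → let y = (y₁ , y₂); α = (a , b); w = y ⊗ᴾ conjᴾ α in
      proj₂ (normSqᴾ α ·ᴾ (con (+ 2) ·ᴾ y ⊖ᴾ α)) := proj₂ (proj₂ w ·ᴾ (α ⊗ᴾ ⟨ θ ⟩ᴾ) ⊕ᴾ (dot2ᴾ w ⟨ 1E ⟩ᴾ :- normSqᴾ α) ·ᴾ α))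
      refl y₁ y₂ a b)

  ⊕-0· : ∀ x y → x ⊕ (0ℤ · y) ≡ x
  ⊕-0· (a , b) (c , d) = cong₂ _,_
    (Poly.solve 4 (λ a b c d → proj₁ ((a , b) ⊕ᴾ con 0ℤ ·ᴾ (c , d)) := a) refl a b c d)
    (Poly.solve 4 (λ a b c d → proj₂ ((a , b) ⊕ᴾ con 0ℤ ·ᴾ (c , d)) := b) refl a b c d)

  N-3s : ∀ N w → N - + 3 * im w ≡ + 2 * (N - dot2 w (unit 1F)) + (dot2 w 1E - N)
  N-3s N (r , s) = Poly.solve 3 (λ N r s →
    N :- con (+ 3) :* s := con (+ 2) :* (N :- dot2ᴾ (r , s) ⟨ unit 1F ⟩ᴾ) :+ (dot2ᴾ (r , s) ⟨ 1E ⟩ᴾ :- N)) refl N r s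

  3s+N : ∀ N w → + 3 * im w - - N ≡ + 2 * (N - dot2 w (unit 5F)) + (dot2 w 1E - N)
  3s+N N (r , s) = Poly.solve 3 (λ N r s →
    con (+ 3) :* s :- :- N := con (+ 2) :* (N :- dot2ᴾ (r , s) ⟨ unit 5F ⟩ᴾ) :+ (dot2ᴾ (r , s) ⟨ 1E ⟩ᴾ :- N)) refl N r s

  2·-⊗ : ∀ y z → ((+ 2) · y) ⊗ z ≡ (+ 2) · (y ⊗ z)
  2·-⊗ (a , b) (c , d) = cong₂ _,_
    (Poly.solve 4 (λ a b c d → proj₁ ((con (+ 2) ·ᴾ (a , b)) ⊗ᴾ (c , d)) := proj₁ (con (+ 2) ·ᴾ ((a , b) ⊗ᴾ (c , d)))) refl a b c d)
    (Poly.solve 4 (λ a b c d → proj₂ ((con (+ 2) ·ᴾ (a , b)) ⊗ᴾ (c , d)) := proj₂ (con (+ 2) ·ᴾ ((a , b) ⊗ᴾ (c , d)))) refl a b c d)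

  ·-cancel : ∀ {N} x → N ≢ 0ℤ → N · x ≡ 0E → x ≡ 0E
  ·-cancel {N} (a , b) N≢0 Nx≡0 = cong₂ _,_ (cancel (cong re Nx≡0)) (cancel (cong im Nx≡0))
    where
    cancel : ∀ {c} → N * c ≡ 0ℤ → c ≡ 0ℤ
    cancel Nc≡0 = [ (λ N≡0 → contradiction N≡0 N≢0) , id ]′ (ℤ.i*j≡0⇒i≡0∨j≡0 N Nc≡0)

-- With y ᾱ = r + s ω on the edge 2r − s = N, we get N (2y − α) = s · α θ; primitivity of α θ forces
-- N ∣ s, while the two neighbouring edges force ∣3s∣ ≤ N, so s = 0 and α = 2y.
edge-free : ∀ α y → Primitive (α ⊗ θ) → InHexagon (normSq α) (y ⊗ conj α) → dot2 (y ⊗ conj α) 1E ≢ normSq α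
edge-free α y prim hex face = primitive⇒prime∤ᴱ prim prime[2] 2∣αθ
  where
  N = normSq α
  w = y ⊗ conj α
  s = im w
  α≢0 : α ≢ 0E
  α≢0 α≡0 = primitive⇒≢0E prim (cong (_⊗ θ) α≡0)
  0≤face-slack : 0ℤ ≤ dot2 w 1E - N
  0≤face-slack = ℤ.≤-reflexive (sym (ℤ.i≡j⇒i-j≡0 face))
  scaled : N · (((+ 2) · y) ⊖ α) ≡ s · (α ⊗ θ)
  scaled = begin
    N · (((+ 2) · y) ⊖ α)                           ≡⟨ edge-identity y α ⟩
    (s · (α ⊗ θ)) ⊕ ((dot2 w 1E - N) · α)         ≡⟨ cong (λ t → (s · (α ⊗ θ)) ⊕ (t · α)) (ℤ.i≡j⇒i-j≡0 face) ⟩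
    (s · (α ⊗ θ)) ⊕ (0ℤ · α)                       ≡⟨ ⊕-0· (s · (α ⊗ θ)) α ⟩
    s · (α ⊗ θ)                                    ∎
    where open ≡-Reasoning
  N∣s : N ∣ s
  N∣s = primitive-∣ᴱ-· prim (subst (N ∣ᴱ_) scaled (∣ᴱ-· N (((+ 2) · y) ⊖ α)))
  3s≤N : + 3 * s ≤ N
  3s≤N = ≤-by-difference (+-nonNeg (*-nonNeg {+ 2} (ℤ.+≤+ ℕ.z≤n) (ℤ.i≤j⇒0≤j-i (hexagon-unit {N} {w} hex 1F))) 0≤face-slack)
    (N-3s N w)
  -N≤3s : - N ≤ + 3 * s
  -N≤3s = ≤-by-difference (+-nonNeg (*-nonNeg {+ 2} (ℤ.+≤+ ℕ.z≤n) (ℤ.i≤j⇒0≤j-i (hexagon-unit {N} {w} hex 5F))) 0≤face-slack)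
    (3s+N N w)
  2y≡α : (+ 2) · y ≡ α
  2y≡α = ⊖≡0E⇒≡ ((+ 2) · y) α (·-cancel (((+ 2) · y) ⊖ α) (λ N≡0 → α≢0 (normSq≡0⇒≡0E α N≡0))
    (trans scaled (cong (_· (α ⊗ θ)) (small-multiple≡0 (normSq-pos α≢0) N∣s -N≤3s 3s≤N))))
  2∣αθ : + 2 ∣ᴱ α ⊗ θ
  2∣αθ = subst (λ z → + 2 ∣ᴱ z ⊗ θ) 2y≡α (subst (+ 2 ∣ᴱ_) (sym (2·-⊗ y θ)) (∣ᴱ-· (+ 2) (y ⊗ θ)))

private
  rotate-comm : ∀ y e α → (y ⊗ conj e) ⊗ conj α ≡ (y ⊗ conj α) ⊗ conj e
  rotate-comm (a , b) (c , d) (e , f) = cong₂ _,_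
    (Poly.solve 6 (λ a b c d e f →
        proj₁ (((a , b) ⊗ᴾ conjᴾ (c , d)) ⊗ᴾ conjᴾ (e , f)) :=
        proj₁ (((a , b) ⊗ᴾ conjᴾ (e , f)) ⊗ᴾ conjᴾ (c , d)))
      refl a b c d e f)
    (Poly.solve 6 (λ a b c d e f →
        proj₂ (((a , b) ⊗ᴾ conjᴾ (c , d)) ⊗ᴾ conjᴾ (e , f)) :=
        proj₂ (((a , b) ⊗ᴾ conjᴾ (e , f)) ⊗ᴾ conjᴾ (c , d)))
      refl a b c d e f)

  1E-⊗ : ∀ x → 1E ⊗ x ≡ x
  1E-⊗ (a , b) = cong₂ _,_
    (Poly.solve 2 (λ a b → proj₁ (⟨ 1E ⟩ᴾ ⊗ᴾ (a , b)) := a) refl a b)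
    (Poly.solve 2 (λ a b → proj₂ (⟨ 1E ⟩ᴾ ⊗ᴾ (a , b)) := b) refl a b)

primitive⇒clean : ∀ α → Primitive (α ⊗ θ) → Clean (mulLattice α)
primitive⇒clean α prim _ x (s , refl) (cell-p , _ , (s′ , refl) , q≢p , cell-q) =
  edge-free α y′ prim (subst (InHexagon N) (sym (rotate-comm y e α)) (hexagon-rotate {N} {w} {e} (normSq-unit k) hex)) face′
  where
  N = normSq α
  y = x ⊖ (α ⊗ s)
  w = y ⊗ conj α
  hex : InHexagon N w
  hex = Equivalence.to (voronoi-cell⇔hexagon α s x) cell-p
  tight : dot2 w (s′ ⊖ s) ≡ N * normSq (s′ ⊖ s)
  tight = Equivalence.to (equidistant⇔tight α s s′ x) (ℤ.≤-antisym (cell-q _ (s , refl)) (cell-p _ (s′ , refl)))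
  s′⊖s≢0 : s′ ⊖ s ≢ 0E
  s′⊖s≢0 = q≢p ∘ cong (α ⊗_) ∘ ⊖≡0E⇒≡ s′ s
  face = hexagon-face {N} {w} {s′ ⊖ s} (normSq-nonNeg α) hex s′⊖s≢0 tight
  k = proj₁ face
  e = unit k
  y′ = y ⊗ conj e
  face′ : dot2 (y′ ⊗ conj α) 1E ≡ N
  face′ = begin
    dot2 (y′ ⊗ conj α) 1E    ≡⟨ cong (λ z → dot2 z 1E) (rotate-comm y e α) ⟩
    dot2 (w ⊗ conj e) 1E     ≡⟨ dot2-⊗-conj w e 1E ⟩
    dot2 w (1E ⊗ e)          ≡⟨ cong (dot2 w) (1E-⊗ e) ⟩
    dot2 w e                 ≡⟨ proj₂ face ⟩
    N                        ∎
    where open ≡-Reasoning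

-- Imprimitive α θ: lattice points on cell boundaries

private
  dot2-ζ : ∀ w → dot2 w (unit 1F) ≡ dot2 w 1E + dot2 w ωE
  dot2-ζ (r , s) = Poly.solve 2 (λ r s → dot2ᴾ (r , s) ⟨ unit 1F ⟩ᴾ := dot2ᴾ (r , s) ⟨ 1E ⟩ᴾ :+ dot2ᴾ (r , s) ⟨ ωE ⟩ᴾ) refl r s

  dot2-ζ³ : ∀ w → dot2 w (unit 3F) ≡ - dot2 w 1E
  dot2-ζ³ (r , s) = Poly.solve 2 (λ r s → dot2ᴾ (r , s) ⟨ unit 3F ⟩ᴾ := :- dot2ᴾ (r , s) ⟨ 1E ⟩ᴾ) refl r s

  dot2-ζ⁴ : ∀ w → dot2 w (unit 4F) ≡ - (dot2 w 1E + dot2 w ωE)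
  dot2-ζ⁴ (r , s) = Poly.solve 2 (λ r s → dot2ᴾ (r , s) ⟨ unit 4F ⟩ᴾ := :- (dot2ᴾ (r , s) ⟨ 1E ⟩ᴾ :+ dot2ᴾ (r , s) ⟨ ωE ⟩ᴾ)) refl r s

  dot2-ζ⁵ : ∀ w → dot2 w (unit 5F) ≡ - dot2 w ωE
  dot2-ζ⁵ (r , s) = Poly.solve 2 (λ r s → dot2ᴾ (r , s) ⟨ unit 5F ⟩ᴾ := :- dot2ᴾ (r , s) ⟨ ωE ⟩ᴾ) refl r s

  ⊖-⊗-0E : ∀ y α → y ⊖ (α ⊗ 0E) ≡ y
  ⊖-⊗-0E (a , b) (c , d) = cong₂ _,_
    (Poly.solve 4 (λ a b c d → proj₁ ((a , b) ⊖ᴾ (c , d) ⊗ᴾ ⟨ 0E ⟩ᴾ) := a) refl a b c d)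
    (Poly.solve 4 (λ a b c d → proj₂ ((a , b) ⊖ᴾ (c , d) ⊗ᴾ ⟨ 0E ⟩ᴾ) := b) refl a b c d)

-- For y ᾱ = r + s ω the hypotheses say 2r − s = N(α) and −N(α) ≤ 3s ≤ N(α), as 2B = 3s − N(α) for
-- B = dot2 (y ᾱ) ω: y lies on the edge of the Voronoi cell of 0 facing α, so also in the cell of α.
edge-point⇒¬clean : ∀ α y → α ≢ 0E → dot2 (y ⊗ conj α) 1E ≡ normSq α →
                    - normSq α ≤ dot2 (y ⊗ conj α) ωE → dot2 (y ⊗ conj α) ωE ≤ 0ℤ → ¬ Clean (mulLattice α)
edge-point⇒¬clean α y α≢0 face -N≤B B≤0 clean =
  clean (α ⊗ 0E) y (0E , refl) (cell-0 , α ⊗ 1E , (1E , refl) , α≢0 ∘ α≡0E , cell-α)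
  where
  N = normSq α
  w = y ⊗ conj α
  A = dot2 w 1E
  B = dot2 w ωE
  0≤N = normSq-nonNeg α
  0≤N+B : 0ℤ ≤ N + B
  0≤N+B = subst (0ℤ ≤_) (trans (ℤ.+-comm B (- - N)) (cong (_+ B) (ℤ.neg-involutive N))) (ℤ.i≤j⇒0≤j-i -N≤B)
  unit-bound : ∀ k → dot2 w (unit k) ≤ N
  unit-bound 0F = ℤ.≤-reflexive face
  unit-bound 1F = begin
    dot2 w (unit 1F) ≡⟨ dot2-ζ w ⟩
    A + B            ≡⟨ cong (_+ B) face ⟩
    N + B            ≤⟨ ℤ.+-monoʳ-≤ N B≤0 ⟩
    N + 0ℤ           ≡⟨ ℤ.+-identityʳ N ⟩
    N                ∎
    where open ℤ.≤-Reasoning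
  unit-bound 2F = ℤ.≤-trans B≤0 0≤N
  unit-bound 3F = begin
    dot2 w (unit 3F) ≡⟨ dot2-ζ³ w ⟩
    - A              ≡⟨ cong -_ face ⟩
    - N              ≤⟨ ℤ.neg-mono-≤ 0≤N ⟩
    0ℤ               ≤⟨ 0≤N ⟩
    N                ∎
    where open ℤ.≤-Reasoning
  unit-bound 4F = begin
    dot2 w (unit 4F) ≡⟨ dot2-ζ⁴ w ⟩
    - (A + B)        ≡⟨ cong (λ t → - (t + B)) face ⟩
    - (N + B)        ≤⟨ ℤ.neg-mono-≤ 0≤N+B ⟩
    0ℤ               ≤⟨ 0≤N ⟩
    N                ∎
    where open ℤ.≤-Reasoning
  unit-bound 5F = begin
    dot2 w (unit 5F) ≡⟨ dot2-ζ⁵ w ⟩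
    - B              ≤⟨ ℤ.neg-mono-≤ -N≤B ⟩
    - - N            ≡⟨ ℤ.neg-involutive N ⟩
    N                ∎
    where open ℤ.≤-Reasoning
  hex : InHexagon N ((y ⊖ (α ⊗ 0E)) ⊗ conj α)
  hex = subst (λ z → InHexagon N (z ⊗ conj α)) (sym (⊖-⊗-0E y α)) (hexagon-from-units {N} {w} 0≤N unit-bound)
  cell-0 : InVoronoiCell (mulLattice α) (α ⊗ 0E) y
  cell-0 = Equivalence.from (voronoi-cell⇔hexagon α 0E y) hex
  cell-α : InVoronoiCell (mulLattice α) (α ⊗ 1E) y
  cell-α = cell-of-equidistant {mulLattice α} {α ⊗ 0E} {α ⊗ 1E} {y} cell-0 (Equivalence.from (equidistant⇔tight α 0E 1E y)
    (trans (cong (λ z → dot2 (z ⊗ conj α) 1E) (⊖-⊗-0E y α)) (trans face (sym (ℤ.*-identityʳ N)))))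
  α≡0E : α ⊗ 1E ≡ α ⊗ 0E → α ≡ 0E
  α≡0E eq = trans (sym (⊗-identityʳ α)) (trans eq (⊗-zeroʳ α))

private
  vertex-face : ∀ ρ → dot2 ((ρ ⊗ ωE) ⊗ conj (θ ⊗ ρ)) 1E ≡ normSq (θ ⊗ ρ)
  vertex-face (r , s) = Poly.solve 2 (λ r s →
    dot2ᴾ (((r , s) ⊗ᴾ ⟨ ωE ⟩ᴾ) ⊗ᴾ conjᴾ (⟨ θ ⟩ᴾ ⊗ᴾ (r , s))) ⟨ 1E ⟩ᴾ := normSqᴾ (⟨ θ ⟩ᴾ ⊗ᴾ (r , s))) refl r s

  vertex-ω : ∀ ρ → dot2 ((ρ ⊗ ωE) ⊗ conj (θ ⊗ ρ)) ωE ≡ 0ℤ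
  vertex-ω (r , s) = Poly.solve 2 (λ r s →
    dot2ᴾ (((r , s) ⊗ᴾ ⟨ ωE ⟩ᴾ) ⊗ᴾ conjᴾ (⟨ θ ⟩ᴾ ⊗ᴾ (r , s))) ⟨ ωE ⟩ᴾ := con 0ℤ) refl r s

-- When θ ∣ α, the lattice point α ω / θ is a vertex of the Voronoi cell of 0.
¬clean-θ-multiple : ∀ ρ → θ ⊗ ρ ≢ 0E → ¬ Clean (mulLattice (θ ⊗ ρ))
¬clean-θ-multiple ρ θρ≢0 = edge-point⇒¬clean (θ ⊗ ρ) (ρ ⊗ ωE) θρ≢0 (vertex-face ρ)
  (subst (- normSq (θ ⊗ ρ) ≤_) (sym (vertex-ω ρ)) (ℤ.neg-mono-≤ (normSq-nonNeg (θ ⊗ ρ))))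
  (ℤ.≤-reflexive (vertex-ω ρ))

private
  scalar-face : ∀ m h j α′ → dot2 ((α′ ⊗ (h , j)) ⊗ conj (m · α′)) 1E ≡ (+ 2 * h - j) * (m * normSq α′)
  scalar-face m h j (a , b) = Poly.solve 5 (λ m h j a b →
    dot2ᴾ (((a , b) ⊗ᴾ (h , j)) ⊗ᴾ conjᴾ (m ·ᴾ (a , b))) ⟨ 1E ⟩ᴾ := (con (+ 2) :* h :- j) :* (m :* normSqᴾ (a , b))) refl m h j a b

  scalar-ω : ∀ m h j α′ → dot2 ((α′ ⊗ (h , j)) ⊗ conj (m · α′)) ωE ≡ - ((h - + 2 * j) * (m * normSq α′))
  scalar-ω m h j (a , b) = Poly.solve 5 (λ m h j a b →
    dot2ᴾ (((a , b) ⊗ᴾ (h , j)) ⊗ᴾ conjᴾ (m ·ᴾ (a , b))) ⟨ ωE ⟩ᴾ := :- ((h :- con (+ 2) :* j) :* (m :* normSqᴾ (a , b)))) refl m h j a b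

-- y = α′ (h + j ω) lies on the edge facing α = m α′.
¬clean-scalar-multiple : ∀ m h j α′ → m ≡ + 2 * h - j → 0ℤ ≤ h - + 2 * j → h - + 2 * j ≤ m →
                         m · α′ ≢ 0E → ¬ Clean (mulLattice (m · α′))
¬clean-scalar-multiple m h j α′ m≡2h-j 0≤t t≤m mα′≢0 =
  edge-point⇒¬clean (m · α′) (α′ ⊗ (h , j)) mα′≢0 face -N≤B B≤0
  where
  P = m * normSq α′
  0≤P : 0ℤ ≤ P
  0≤P = *-nonNeg (ℤ.≤-trans 0≤t t≤m) (normSq-nonNeg α′)
  face = trans (scalar-face m h j α′) (trans (cong (_* P) (sym m≡2h-j)) (sym (normSq-· m α′)))
  B≤0 = subst (_≤ 0ℤ) (sym (scalar-ω m h j α′)) (ℤ.neg-mono-≤ (*-nonNeg 0≤t 0≤P))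
  -N≤B = subst₂ (λ N B → - N ≤ B) (sym (normSq-· m α′)) (sym (scalar-ω m h j α′))
    (ℤ.neg-mono-≤ (ℤ.*-monoʳ-≤-nonNeg P {{ℤ.nonNegative 0≤P}} t≤m))

private
  parity : ∀ n → (∃ λ h → n ≡ h ℕ.+ h) ⊎ (∃ λ h → n ≡ suc (h ℕ.+ h))
  parity zero = inj₁ (0 , refl)
  parity (suc n) with parity n
  ... | inj₁ (h , n≡2h) = inj₂ (h , cong suc n≡2h)
  ... | inj₂ (h , n≡2h+1) = inj₁ (suc h , cong suc (trans n≡2h+1 (sym (ℕ.+-suc h h))))

  even-conditions : ∀ H → 0ℤ ≤ H → H + H ≡ + 2 * H - 0ℤ × 0ℤ ≤ H - + 2 * 0ℤ × H - + 2 * 0ℤ ≤ H + H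
  even-conditions H 0≤H =
    solve (H ∷ []) ,
    ≤-by-difference 0≤H (solve (H ∷ [])) ,
    ≤-by-difference 0≤H (solve (H ∷ []))

  odd-conditions : ∀ H → 1ℤ ≤ H → 1ℤ + (H + H) ≡ + 2 * H - -1ℤ × 0ℤ ≤ H - + 2 * -1ℤ × H - + 2 * -1ℤ ≤ 1ℤ + (H + H)
  odd-conditions H 1≤H =
    solve (H ∷ []) ,
    ≤-by-difference (+-nonNeg {H} {+ 2} (ℤ.≤-trans (ℤ.+≤+ ℕ.z≤n) 1≤H) (ℤ.+≤+ ℕ.z≤n)) (solve (H ∷ [])) ,
    ≤-by-difference (ℤ.i≤j⇒0≤j-i 1≤H) (solve (H ∷ []))

¬clean-multiple : ∀ m α′ → 2 ℕ.≤ m → (+ m) · α′ ≢ 0E → ¬ Clean (mulLattice ((+ m) · α′))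
¬clean-multiple m α′ 2≤m mα′≢0 with parity m
... | inj₁ (h , refl) =
  let (m≡ , 0≤t , t≤m) = even-conditions (+ h) (ℤ.+≤+ ℕ.z≤n)
  in subst (λ m → m · α′ ≢ 0E → ¬ Clean (mulLattice (m · α′))) (sym (ℤ.pos-+ h h))
       (¬clean-scalar-multiple (+ h + + h) (+ h) 0ℤ α′ m≡ 0≤t t≤m) mα′≢0
... | inj₂ (zero , refl) = contradiction 2≤m λ { (ℕ.s≤s ()) }
... | inj₂ (suc h , refl) =
  let (m≡ , 0≤t , t≤m) = odd-conditions (+ suc h) (ℤ.+≤+ (ℕ.s≤s ℕ.z≤n))
  in subst (λ m → m · α′ ≢ 0E → ¬ Clean (mulLattice (m · α′))) (cong (λ n → 1ℤ + n) (sym (ℤ.pos-+ (suc h) (suc h))))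
       (¬clean-scalar-multiple (1ℤ + (+ suc h + + suc h)) (+ suc h) -1ℤ α′ m≡ 0≤t t≤m) mα′≢0

private
  3a-from-⊗θ : ∀ a b → + 2 * im ((a , b) ⊗ θ) - re ((a , b) ⊗ θ) ≡ + 3 * a
  3a-from-⊗θ a b = Poly.solve 2 (λ a b → con (+ 2) :* proj₂ ((a , b) ⊗ᴾ ⟨ θ ⟩ᴾ) :- proj₁ ((a , b) ⊗ᴾ ⟨ θ ⟩ᴾ) := con (+ 3) :* a) refl a b

  3b-from-⊗θ : ∀ a b → im ((a , b) ⊗ θ) - + 2 * re ((a , b) ⊗ θ) ≡ + 3 * b
  3b-from-⊗θ a b = Poly.solve 2 (λ a b → proj₂ ((a , b) ⊗ᴾ ⟨ θ ⟩ᴾ) :- con (+ 2) :* proj₁ ((a , b) ⊗ᴾ ⟨ θ ⟩ᴾ) := con (+ 3) :* b) refl a b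

θ-divides : ∀ α → + 3 ∣ᴱ α ⊗ θ → ∃ λ ρ → α ≡ θ ⊗ ρ
θ-divides (a , b) (divides k₁ r≡ , divides k₂ s≡) =
  (- k₁ , - k₂) , cong₂ _,_ (ℤ.*-cancelˡ-≡ (+ 3) _ _ 3a≡) (ℤ.*-cancelˡ-≡ (+ 3) _ _ 3b≡)
  where
  open ≡-Reasoning
  3a≡ : + 3 * a ≡ + 3 * re (θ ⊗ (- k₁ , - k₂))
  3a≡ = begin
    + 3 * a                                          ≡⟨ 3a-from-⊗θ a b ⟨
    + 2 * im ((a , b) ⊗ θ) - re ((a , b) ⊗ θ)        ≡⟨ cong₂ (λ s r → + 2 * s - r) s≡ r≡ ⟩
    + 2 * (k₂ * + 3) - k₁ * + 3                      ≡⟨ Poly.solve 2 (λ k₁ k₂ → con (+ 2) :* (k₂ :* con (+ 3)) :- k₁ :* con (+ 3) := con (+ 3) :* proj₁ (⟨ θ ⟩ᴾ ⊗ᴾ (:- k₁ , :- k₂))) refl k₁ k₂ ⟩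
    + 3 * re (θ ⊗ (- k₁ , - k₂))                     ∎
  3b≡ : + 3 * b ≡ + 3 * im (θ ⊗ (- k₁ , - k₂))
  3b≡ = begin
    + 3 * b                                          ≡⟨ 3b-from-⊗θ a b ⟨
    im ((a , b) ⊗ θ) - + 2 * re ((a , b) ⊗ θ)        ≡⟨ cong₂ (λ s r → s - + 2 * r) s≡ r≡ ⟩
    k₂ * + 3 - + 2 * (k₁ * + 3)                      ≡⟨ Poly.solve 2 (λ k₁ k₂ → k₂ :* con (+ 3) :- con (+ 2) :* (k₁ :* con (+ 3)) := con (+ 3) :* proj₂ (⟨ θ ⟩ᴾ ⊗ᴾ (:- k₁ , :- k₂))) refl k₁ k₂ ⟩
    + 3 * im (θ ⊗ (- k₁ , - k₂))                     ∎

-- 3a and 3b are integer combinations of the coordinates of α θ.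
θ-prime-divisor : ∀ {q} α → Prime q → + q ∣ᴱ α ⊗ θ → (∃ λ ρ → α ≡ θ ⊗ ρ) ⊎ + q ∣ᴱ α
θ-prime-divisor {q} (a , b) prime-q q∣αθ@(q∣r , q∣s) =
  combine (prime-∣-* (+ 3) a prime-q q∣3a) (prime-∣-* (+ 3) b prime-q q∣3b)
  where
  q∣3a : + q ∣ + 3 * a
  q∣3a = subst (+ q ∣_) (3a-from-⊗θ a b) (∣m∣n⇒∣m-n (∣n⇒∣m*n (+ 2) q∣s) q∣r)
  q∣3b : + q ∣ + 3 * b
  q∣3b = subst (+ q ∣_) (3b-from-⊗θ a b) (∣m∣n⇒∣m-n q∣s (∣n⇒∣m*n (+ 2) q∣r))
  θ∣α : (+ q) ∣ + 3 → ∃ λ ρ → (a , b) ≡ θ ⊗ ρ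
  θ∣α q∣3 = θ-divides (a , b) (subst (λ p → + p ∣ᴱ (a , b) ⊗ θ) (prime-∣-prime prime[3] prime-q q∣3) q∣αθ)
  combine : ((+ q) ∣ + 3 ⊎ (+ q) ∣ a) → ((+ q) ∣ + 3 ⊎ (+ q) ∣ b) → (∃ λ ρ → (a , b) ≡ θ ⊗ ρ) ⊎ + q ∣ᴱ (a , b)
  combine (inj₁ q∣3) _ = inj₁ (θ∣α q∣3)
  combine (inj₂ _) (inj₁ q∣3) = inj₁ (θ∣α q∣3)
  combine (inj₂ q∣a) (inj₂ q∣b) = inj₂ (q∣a , q∣b)

clean⇒primitive : ∀ α → α ≢ 0E → Clean (mulLattice α) → Primitive (α ⊗ θ)
clean⇒primitive α α≢0 clean = decidable-stable (primitive? (α ⊗ θ)) λ ¬prim →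
  let (q , prime-q , q∣αθ) = ¬primitive⇒prime-∣ᴱ (α ⊗ θ) αθ≢0 ¬prim
  in Sum.[ θ-case , scalar-case prime-q ]′ (θ-prime-divisor α prime-q q∣αθ)
  where
  αθ≢0 : α ⊗ θ ≢ 0E
  αθ≢0 αθ≡0 = Sum.[ α≢0 , (λ ()) ]′ (⊗-zero-divisor α θ αθ≡0)
  θ-case : (∃ λ ρ → α ≡ θ ⊗ ρ) → ⊥
  θ-case (ρ , α≡θρ) = ¬clean-θ-multiple ρ (subst (_≢ 0E) α≡θρ α≢0) (subst (Clean ∘ mulLattice) α≡θρ clean)
  scalar-case : ∀ {q} → Prime q → + q ∣ᴱ α → ⊥
  scalar-case {q} prime-q q∣α =
    let (α′ , α≡qα′) = ∣ᴱ⇒· α q∣α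
    in ¬clean-multiple q α′ (ℕ.nonTrivial⇒n>1 q {{prime⇒nonTrivial prime-q}}) (subst (_≢ 0E) α≡qα′ α≢0)
         (subst (Clean ∘ mulLattice) α≡qα′ clean)

-- Similar sublattices and their index

private
  toℚ≡mkℚ : ∀ X → toℚ X ≡ mkℚ X 0 (ℕ.sym (ℕ.1-coprimeTo ℤ.∣ X ∣))
  toℚ≡mkℚ X = ℚ.↥p/↧p≡p (mkℚ X 0 (ℕ.sym (ℕ.1-coprimeTo ℤ.∣ X ∣)))

toℚ-* : ∀ X K → toℚ (X * K) ≡ toℚ X ℚ.* toℚ K
toℚ-* X K rewrite toℚ≡mkℚ X | toℚ≡mkℚ K | toℚ≡mkℚ (X * K) =
  ℚ.toℚᵘ-injective (ℚᵘ.*≡* (cong (λ d → X * K * + suc d) (ℕ.*-identityʳ 0)))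

toℚ-pos : ∀ {X} → 0ℤ ℤ.< X → ℚ.0ℚ ℚ.< toℚ X
toℚ-pos {X} 0<X rewrite toℚ≡mkℚ X = ℚ.*<* (subst (0ℤ ℤ.<_) (sym (ℤ.*-identityʳ X)) 0<X)

cross-multiply : ∀ X K c → toℚ X ≡ c ℚ.* toℚ K → X * ↧ c ≡ ↥ c * K
cross-multiply X K c@(mkℚ n d _) eq with ℚᵘ.≃-trans (ℚ.toℚᵘ-cong eq) (ℚ.toℚᵘ-homo-* c (toℚ K))
... | X≃cK rewrite toℚ≡mkℚ X | toℚ≡mkℚ K with X≃cK
... | ℚᵘ.*≡* eq′ = trans (cong (λ d → X * + suc d) (sym (ℕ.*-identityʳ d))) (trans eq′ (ℤ.*-identityʳ (n * K)))

0<↥ : ∀ {c} → ℚ.0ℚ ℚ.< c → 0ℤ ℤ.< ↥ c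
0<↥ {mkℚ n _ _} (ℚ.*<* 0<n*1) = subst (0ℤ ℤ.<_) (ℤ.*-identityʳ n) 0<n*1

Clean-resp-≐ : ∀ {L L′ : Sub} → L ≐ L′ → Clean L′ → Clean L
Clean-resp-≐ {L} {L′} (L⊆L′ , L′⊆L) clean p x p∈L (cell-p , q , q∈L , q≢p , cell-q) =
  clean p x (L⊆L′ p∈L) (cell cell-p , q , L⊆L′ q∈L , q≢p , cell cell-q)
  where
  cell : ∀ {s} → InVoronoiCell L s x → InVoronoiCell L′ s x
  cell c r r∈L′ = c r (L′⊆L r∈L′)

HasIndex-resp-≐ : ∀ {L L′ : Sub} {n} → L ≐ L′ → HasIndex L n → HasIndex L′ n
HasIndex-resp-≐ (L⊆L′ , L′⊆L) (rep , distinct , cover) =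
  rep , (λ i j → distinct i j ∘ L′⊆L) , (λ x → proj₁ (cover x) , L⊆L′ (proj₂ (cover x)))

index-unique : ∀ {L : Sub} {m n} →
               (∀ {y z} → Congruent L y z → Congruent L z y) →
               (∀ {y z w} → Congruent L y z → Congruent L z w → Congruent L y w) →
               HasIndex L m → HasIndex L n → m ≡ n
index-unique {L} sym′ trans′ I J = ℕ.≤-antisym (index-≤ I J) (index-≤ J I)
  where
  index-≤ : ∀ {m n} → HasIndex L m → HasIndex L n → m ℕ.≤ n
  index-≤ (rep , distinct , _) (rep′ , _ , cover′) = Fin.injective⇒≤ f-injective
    where
    f = λ i → proj₁ (cover′ (rep i))
    f-injective : ∀ {i j} → f i ≡ f j → i ≡ j
    f-injective {i} {j} fi≡fj = distinct i j (trans′ {rep i} {rep′ (f i)} {rep j} (proj₂ (cover′ (rep i)))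
      (sym′ {rep j} {rep′ (f i)} (subst (λ k → Congruent L (rep j) (rep′ k)) (sym fi≡fj) (proj₂ (cover′ (rep j))))))

private
  ⊗-neg : ∀ α β → α ⊗ (0E ⊖ β) ≡ 0E ⊖ (α ⊗ β)
  ⊗-neg (a , b) (c , d) = cong₂ _,_
    (Poly.solve 4 (λ a b c d → proj₁ ((a , b) ⊗ᴾ (⟨ 0E ⟩ᴾ ⊖ᴾ (c , d))) := proj₁ (⟨ 0E ⟩ᴾ ⊖ᴾ (a , b) ⊗ᴾ (c , d))) refl a b c d)
    (Poly.solve 4 (λ a b c d → proj₂ ((a , b) ⊗ᴾ (⟨ 0E ⟩ᴾ ⊖ᴾ (c , d))) := proj₂ (⟨ 0E ⟩ᴾ ⊖ᴾ (a , b) ⊗ᴾ (c , d))) refl a b c d)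

  ⊗-distribˡ-⊕ : ∀ α β γ → α ⊗ (β ⊕ γ) ≡ (α ⊗ β) ⊕ (α ⊗ γ)
  ⊗-distribˡ-⊕ (a , b) (c , d) (e , f) = cong₂ _,_
    (Poly.solve 6 (λ a b c d e f →
        proj₁ ((a , b) ⊗ᴾ ((c , d) ⊕ᴾ (e , f))) :=
        proj₁ ((a , b) ⊗ᴾ (c , d) ⊕ᴾ (a , b) ⊗ᴾ (e , f))) refl a b c d e f)
    (Poly.solve 6 (λ a b c d e f →
        proj₂ ((a , b) ⊗ᴾ ((c , d) ⊕ᴾ (e , f))) :=
        proj₂ ((a , b) ⊗ᴾ (c , d) ⊕ᴾ (a , b) ⊗ᴾ (e , f))) refl a b c d e f)

  ⊖-anticomm : ∀ y z → 0E ⊖ (y ⊖ z) ≡ z ⊖ y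
  ⊖-anticomm (a , b) (c , d) = cong₂ _,_
    (Poly.solve 4 (λ a b c d → proj₁ (⟨ 0E ⟩ᴾ ⊖ᴾ ((a , b) ⊖ᴾ (c , d))) := proj₁ ((c , d) ⊖ᴾ (a , b))) refl a b c d)
    (Poly.solve 4 (λ a b c d → proj₂ (⟨ 0E ⟩ᴾ ⊖ᴾ ((a , b) ⊖ᴾ (c , d))) := proj₂ ((c , d) ⊖ᴾ (a , b))) refl a b c d)

  ⊖-telescope : ∀ y z w → (y ⊖ z) ⊕ (z ⊖ w) ≡ y ⊖ w
  ⊖-telescope (a , b) (c , d) (e , f) = cong₂ _,_
    (Poly.solve 6 (λ a b c d e f → proj₁ (((a , b) ⊖ᴾ (c , d)) ⊕ᴾ ((c , d) ⊖ᴾ (e , f))) := proj₁ ((a , b) ⊖ᴾ (e , f))) refl a b c d e f)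
    (Poly.solve 6 (λ a b c d e f → proj₂ (((a , b) ⊖ᴾ (c , d)) ⊕ᴾ ((c , d) ⊖ᴾ (e , f))) := proj₂ ((a , b) ⊖ᴾ (e , f))) refl a b c d e f)

mulLattice-congruent-sym : ∀ α {y z} → Congruent (mulLattice α) y z → Congruent (mulLattice α) z y
mulLattice-congruent-sym α {y} {z} (β , αβ≡y-z) =
  0E ⊖ β , trans (⊗-neg α β) (trans (cong (0E ⊖_) αβ≡y-z) (⊖-anticomm y z))

mulLattice-congruent-trans : ∀ α {y z w} → Congruent (mulLattice α) y z → Congruent (mulLattice α) z w →
                             Congruent (mulLattice α) y w
mulLattice-congruent-trans α {y} {z} {w} (β , αβ≡y-z) (γ , αγ≡z-w) =
  β ⊕ γ , trans (⊗-distribˡ-⊕ α β γ) (trans (cong₂ _⊕_ αβ≡y-z αγ≡z-w) (⊖-telescope y z w))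

private
  conj-⊗-⊗ : ∀ α β → conj α ⊗ (α ⊗ β) ≡ normSq α · β
  conj-⊗-⊗ (a , b) (c , d) = cong₂ _,_
    (Poly.solve 4 (λ a b c d → proj₁ (conjᴾ (a , b) ⊗ᴾ ((a , b) ⊗ᴾ (c , d))) := proj₁ (normSqᴾ (a , b) ·ᴾ (c , d))) refl a b c d)
    (Poly.solve 4 (λ a b c d → proj₂ (conjᴾ (a , b) ⊗ᴾ ((a , b) ⊗ᴾ (c , d))) := proj₂ (normSqᴾ (a , b) ·ᴾ (c , d))) refl a b c d)

  conj-⊗-integer : ∀ α d → conj α ⊗ (d , 0ℤ) ≡ d · conj α
  conj-⊗-integer (a , b) d = cong₂ _,_
    (Poly.solve 3 (λ a b d → proj₁ (conjᴾ (a , b) ⊗ᴾ (d , con 0ℤ)) := proj₁ (d ·ᴾ conjᴾ (a , b))) refl a b d)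
    (Poly.solve 3 (λ a b d → proj₂ (conjᴾ (a , b) ⊗ᴾ (d , con 0ℤ)) := proj₂ (d ·ᴾ conjᴾ (a , b))) refl a b d)

-- ᾱ (α β) = N(α) β, and ᾱ is primitive with α.
integer∈mulLattice⇒∣ : ∀ α d → Primitive α → mulLattice α (d , 0ℤ) → normSq α ∣ d
integer∈mulLattice⇒∣ α d prim (β , αβ≡d) =
  primitive-∣ᴱ-· (primitive-conj α prim) (subst (normSq α ∣ᴱ_) Nβ≡dᾱ (∣ᴱ-· (normSq α) β))
  where
  Nβ≡dᾱ : normSq α · β ≡ d · conj α
  Nβ≡dᾱ = trans (sym (conj-⊗-⊗ α β)) (trans (cong (conj α ⊗_) αβ≡d) (conj-⊗-integer α d))

private
  small-multiple : ∀ {N d} → N ℕ.∣ d → d ℕ.< N → d ≡ 0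
  small-multiple {d = zero} _ _ = refl
  small-multiple {d = suc d} N∣d d<N = contradiction (ℕ.∣⇒≤ N∣d) (ℕ.<⇒≱ d<N)

residues-congruent : ∀ {N i j} → i ℕ.< N → j ℕ.< N → (+ N) ∣ (+ i - + j) → i ≡ j
residues-congruent {N} {i} {j} i<N j<N N∣i-j =
  ℤ.+-injective (ℤ.i-j≡0⇒i≡j (+ i) (+ j) (trans (ℤ.[+m]-[+n]≡m⊖n i j) (ℤ.∣i∣≡0⇒i≡0 ∣i⊖j∣≡0)))
  where
  ∣i⊖j∣≡0 : ℤ.∣ i ℤ.⊖ j ∣ ≡ 0
  ∣i⊖j∣≡0 = small-multiple (subst (λ d → N ℕ.∣ ℤ.∣ d ∣) (ℤ.[+m]-[+n]≡m⊖n i j) (∣⇒∣ᵤ N∣i-j))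
    (ℕ.≤-<-trans (ℤ.∣m⊝n∣≤m⊔n i j) (ℕ.⊔-lub i<N j<N))

private
  bezout-pair : ∀ α u v → u * re α + v * im α ≡ 1ℤ → im (α ⊗ (u + v , u)) ≡ 1ℤ
  bezout-pair (a , b) u v bezout = begin
    im ((a , b) ⊗ (u + v , u)) ≡⟨ Poly.solve 4 (λ a b u v → proj₂ ((a , b) ⊗ᴾ (u :+ v , u)) := u :* a :+ v :* b) refl a b u v ⟩
    u * a + v * b              ≡⟨ bezout ⟩
    1ℤ                         ∎
    where open ≡-Reasoning

  shift-to-integer : ∀ z p → z ⊖ (re z - im z * p , 0ℤ) ≡ im z · (p , 1ℤ)
  shift-to-integer (z₁ , z₂) p = cong₂ _,_
    (Poly.solve 3 (λ z₁ z₂ p → proj₁ ((z₁ , z₂) ⊖ᴾ (z₁ :- z₂ :* p , con 0ℤ)) := proj₁ (z₂ ·ᴾ (p , con 1ℤ))) refl z₁ z₂ p)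
    (Poly.solve 3 (λ z₁ z₂ p → proj₂ ((z₁ , z₂) ⊖ᴾ (z₁ :- z₂ :* p , con 0ℤ)) := proj₂ (z₂ ·ᴾ (p , con 1ℤ))) refl z₁ z₂ p)

  ⊗-· : ∀ α k β → α ⊗ (k · β) ≡ k · (α ⊗ β)
  ⊗-· (a , b) k (c , d) = cong₂ _,_
    (Poly.solve 5 (λ a b k c d → proj₁ ((a , b) ⊗ᴾ (k ·ᴾ (c , d))) := proj₁ (k ·ᴾ ((a , b) ⊗ᴾ (c , d)))) refl a b k c d)
    (Poly.solve 5 (λ a b k c d → proj₂ ((a , b) ⊗ᴾ (k ·ᴾ (c , d))) := proj₂ (k ·ᴾ ((a , b) ⊗ᴾ (c , d)))) refl a b k c d)

  i+j-i≡j : ∀ i j → (i + j) - i ≡ j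
  i+j-i≡j = solve-∀

  ⊗-·-conj : ∀ α q → α ⊗ (q · conj α) ≡ (q * normSq α , 0ℤ)
  ⊗-·-conj (a , b) q = cong₂ _,_
    (Poly.solve 3 (λ a b q → proj₁ ((a , b) ⊗ᴾ (q ·ᴾ conjᴾ (a , b))) := q :* normSqᴾ (a , b)) refl a b q)
    (Poly.solve 3 (λ a b q → proj₂ ((a , b) ⊗ᴾ (q ·ᴾ conjᴾ (a , b))) := con 0ℤ) refl a b q)

-- Some α β equals p + ω, so every z is congruent to an integer.
congruent-to-integer : ∀ α → Primitive α → ∀ z → ∃ λ c → Congruent (mulLattice α) z (c , 0ℤ)
congruent-to-integer α prim z =
  let (u , v , bezout) = primitive-bezout {re α} {im α} prim
      β = (u + v , u)
      αβ≡p+ω : α ⊗ β ≡ (re (α ⊗ β) , 1ℤ)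
      αβ≡p+ω = cong (re (α ⊗ β) ,_) (bezout-pair α u v bezout)
  in re z - im z * re (α ⊗ β) ,
     im z · β ,
     (begin
       α ⊗ (im z · β)                            ≡⟨ ⊗-· α (im z) β ⟩
       im z · (α ⊗ β)                            ≡⟨ cong (im z ·_) αβ≡p+ω ⟩
       im z · (re (α ⊗ β) , 1ℤ)                  ≡⟨ shift-to-integer z (re (α ⊗ β)) ⟨
       z ⊖ (re z - im z * re (α ⊗ β) , 0ℤ)        ∎)
  where open ≡-Reasoning

integer-congruent-residue : ∀ α c → .{{_ : ℕ.NonZero ℤ.∣ normSq α ∣}} →
  Congruent (mulLattice α) (c , 0ℤ) (+ (c %ℕ ℤ.∣ normSq α ∣) , 0ℤ)
integer-congruent-residue α c = (c /ℕ N) · conj α , cong₂ _,_ c-r≡qN (cong im (⊗-·-conj α (c /ℕ N)))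
  where
  N = ℤ.∣ normSq α ∣
  q = c /ℕ N
  r = + (c %ℕ N)
  c-r≡qN : re (α ⊗ (q · conj α)) ≡ c - r
  c-r≡qN = begin
    re (α ⊗ (q · conj α))  ≡⟨ cong re (⊗-·-conj α q) ⟩
    q * normSq α           ≡⟨ cong (q *_) (ℤ.0≤i⇒+∣i∣≡i (normSq-nonNeg α)) ⟨
    q * + N                ≡⟨ i+j-i≡j r (q * + N) ⟨
    (r + q * + N) - r      ≡⟨ cong (_- r) (a≡a%ℕn+[a/ℕn]*n c N) ⟨
    c - r                  ∎
    where open ≡-Reasoning

index-of-primitive : ∀ α → Primitive α → HasIndex (mulLattice α) ℤ.∣ normSq α ∣
index-of-primitive α prim = rep , distinct , cover
  where
  N = ℤ.∣ normSq α ∣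
  +N≡normSq : + N ≡ normSq α
  +N≡normSq = ℤ.0≤i⇒+∣i∣≡i (normSq-nonNeg α)
  instance
    _ : ℕ.NonZero N
    _ = ℕ.≢-nonZero (λ N≡0 → primitive⇒≢0E prim (normSq≡0⇒≡0E α (trans (sym +N≡normSq) (cong +_ N≡0))))
  rep : Fin N → Eis
  rep i = (+ toℕ i , 0ℤ)
  distinct : ∀ i j → Congruent (mulLattice α) (rep i) (rep j) → i ≡ j
  distinct i j i≡j = Fin.toℕ-injective (residues-congruent (Fin.toℕ<n i) (Fin.toℕ<n j)
    (subst (_∣ (+ toℕ i - + toℕ j)) (sym +N≡normSq) (integer∈mulLattice⇒∣ α _ prim i≡j)))
  cover : ∀ z → ∃ λ i → Congruent (mulLattice α) z (rep i)
  cover z =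
    let (c , z≡c) = congruent-to-integer α prim z
        r<N = n%ℕd<d c N
    in fromℕ< r<N ,
       mulLattice-congruent-trans α {z} {c , 0ℤ} {rep (fromℕ< r<N)} z≡c
         (subst (λ r → Congruent (mulLattice α) (c , 0ℤ) (+ r , 0ℤ)) (sym (Fin.toℕ-fromℕ< r<N))
           (integer-congruent-residue α c))

private
  ω² : Eis
  ω² = ωE ⊗ ωE

  apply-1E : ∀ σ → apply σ 1E ≡ proj₁ σ
  apply-1E ((a , b) , (c , d)) = cong₂ _,_
    (Poly.solve 4 (λ a b c d → proj₁ (con 1ℤ ·ᴾ (a , b) ⊕ᴾ con 0ℤ ·ᴾ (c , d)) := a) refl a b c d)
    (Poly.solve 4 (λ a b c d → proj₂ (con 1ℤ ·ᴾ (a , b) ⊕ᴾ con 0ℤ ·ᴾ (c , d)) := b) refl a b c d)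

  apply-ωE : ∀ σ → apply σ ωE ≡ proj₂ σ
  apply-ωE ((a , b) , (c , d)) = cong₂ _,_
    (Poly.solve 4 (λ a b c d → proj₁ (con 0ℤ ·ᴾ (a , b) ⊕ᴾ con 1ℤ ·ᴾ (c , d)) := c) refl a b c d)
    (Poly.solve 4 (λ a b c d → proj₂ (con 0ℤ ·ᴾ (a , b) ⊕ᴾ con 1ℤ ·ᴾ (c , d)) := d) refl a b c d)

  apply-rotation : ∀ α β → apply (α , α ⊗ ωE) β ≡ α ⊗ β
  apply-rotation (a , b) (c , d) = cong₂ _,_
    (Poly.solve 4 (λ a b c d → proj₁ (c ·ᴾ (a , b) ⊕ᴾ d ·ᴾ ((a , b) ⊗ᴾ ⟨ ωE ⟩ᴾ)) := proj₁ ((a , b) ⊗ᴾ (c , d))) refl a b c d)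
    (Poly.solve 4 (λ a b c d → proj₂ (c ·ᴾ (a , b) ⊕ᴾ d ·ᴾ ((a , b) ⊗ᴾ ⟨ ωE ⟩ᴾ)) := proj₂ ((a , b) ⊗ᴾ (c , d))) refl a b c d)

  apply-reflection : ∀ α β → apply (α , α ⊗ ω²) β ≡ α ⊗ conj β
  apply-reflection (a , b) (c , d) = cong₂ _,_
    (Poly.solve 4 (λ a b c d → proj₁ (c ·ᴾ (a , b) ⊕ᴾ d ·ᴾ ((a , b) ⊗ᴾ ⟨ ω² ⟩ᴾ)) := proj₁ ((a , b) ⊗ᴾ conjᴾ (c , d))) refl a b c d)
    (Poly.solve 4 (λ a b c d → proj₂ (c ·ᴾ (a , b) ⊕ᴾ d ·ᴾ ((a , b) ⊗ᴾ ⟨ ω² ⟩ᴾ)) := proj₂ ((a , b) ⊗ᴾ conjᴾ (c , d))) refl a b c d)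

  dot2-self : ∀ x → dot2 x x ≡ + 2 * normSq x
  dot2-self (a , b) = Poly.solve 2 (λ a b → dot2ᴾ (a , b) (a , b) := con (+ 2) :* normSqᴾ (a , b)) refl a b

  dot2-⊗ : ∀ α u v → dot2 (α ⊗ u) (α ⊗ v) ≡ normSq α * dot2 u v
  dot2-⊗ (a , b) (c , d) (e , f) =
    Poly.solve 6 (λ a b c d e f →
        dot2ᴾ ((a , b) ⊗ᴾ (c , d)) ((a , b) ⊗ᴾ (e , f)) :=
        normSqᴾ (a , b) :* dot2ᴾ (c , d) (e , f)) refl a b c d e f

  -- (y − x ω)(y − x ω²) = y² + x y + x², multiplied by x̄
  factorisation : ∀ x y → conj x ⊗ ((y ⊖ (x ⊗ ωE)) ⊗ (y ⊖ (x ⊗ ω²))) ≡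
                          ((dot2 x y + normSq x) · y) ⊖ ((normSq y - normSq x) · x)
  factorisation (a , b) (c , d) = cong₂ _,_
    (Poly.solve 4 (λ a b c d → let x = (a , b); y = (c , d) in
      proj₁ (conjᴾ x ⊗ᴾ ((y ⊖ᴾ x ⊗ᴾ ⟨ ωE ⟩ᴾ) ⊗ᴾ (y ⊖ᴾ x ⊗ᴾ ⟨ ω² ⟩ᴾ))) :=
      proj₁ ((dot2ᴾ x y :+ normSqᴾ x) ·ᴾ y ⊖ᴾ (normSqᴾ y :- normSqᴾ x) ·ᴾ x)) refl a b c d)
    (Poly.solve 4 (λ a b c d → let x = (a , b); y = (c , d) in
      proj₂ (conjᴾ x ⊗ᴾ ((y ⊖ᴾ x ⊗ᴾ ⟨ ωE ⟩ᴾ) ⊗ᴾ (y ⊖ᴾ x ⊗ᴾ ⟨ ω² ⟩ᴾ))) :=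
      proj₂ ((dot2ᴾ x y :+ normSqᴾ x) ·ᴾ y ⊖ᴾ (normSqᴾ y :- normSqᴾ x) ·ᴾ x)) refl a b c d)

image-rotation : ∀ α → image (α , α ⊗ ωE) ≐ mulLattice α
image-rotation α =
  (λ { (β , eq) → β , trans (sym (apply-rotation α β)) eq }) ,
  (λ { (β , eq) → β , trans (apply-rotation α β) eq })

image-reflection : ∀ α → image (α , α ⊗ ω²) ≐ mulLattice α
image-reflection α =
  (λ { (β , eq) → conj β , trans (sym (apply-reflection α β)) eq }) ,
  (λ { (β , eq) → conj β , trans (apply-reflection α (conj β)) (trans (cong (α ⊗_) (conj-involutive β)) eq) })

rotation-isSimilarity : ∀ α → α ≢ 0E → IsSimilarity (α , α ⊗ ωE)
rotation-isSimilarity α α≢0 = toℚ (normSq α) , toℚ-pos (normSq-pos α≢0) , λ u v →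
  trans (cong toℚ (trans (cong₂ dot2 (apply-rotation α u) (apply-rotation α v)) (dot2-⊗ α u v)))
        (toℚ-* (normSq α) (dot2 u v))

-- y/x has modulus 1 and real part −1/2, so it is ω or ω².
ω-or-ω² : ∀ x y → x ≢ 0E → normSq y ≡ normSq x → dot2 x y + normSq x ≡ 0ℤ → y ≡ x ⊗ ωE ⊎ y ≡ x ⊗ ω²
ω-or-ω² x y x≢0 Ny≡Nx dot≡-N =
  Sum.map (⊖≡0E⇒≡ y (x ⊗ ωE)) (⊖≡0E⇒≡ y (x ⊗ ω²))
    (⊗-zero-divisor (y ⊖ (x ⊗ ωE)) (y ⊖ (x ⊗ ω²))
      (Sum.[ (λ x̄≡0 → contradiction (trans (sym (conj-involutive x)) (cong conj x̄≡0)) x≢0) , (λ p≡0 → p≡0) ]′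
        (⊗-zero-divisor (conj x) _ x̄p≡0)))
  where
  x̄p≡0 : conj x ⊗ ((y ⊖ (x ⊗ ωE)) ⊗ (y ⊖ (x ⊗ ω²))) ≡ 0E
  x̄p≡0 = trans (factorisation x y) (cong₂ (λ s t → (s · y) ⊖ (t · x)) dot≡-N (ℤ.i≡j⇒i-j≡0 Ny≡Nx))

-- Evaluating the similarity condition at (1,1), (ω,ω) and (1,ω) gives N(σω) = N(σ1) and
-- dot2 (σ1) (σω) = −N(σ1).
similarity-image : ∀ σ → IsSimilarity σ → ∃ λ α → α ≢ 0E × image σ ≐ mulLattice α
similarity-image σ@(x , y) (c , 0<c , preserves) = x , x≢0 , image≐ (ω-or-ω² x y x≢0 Ny≡Nx dot≡-N)
  where
  D = ↧ c
  n = ↥ c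
  instance
    _ : ℤ.NonZero D
    _ = ℤ.>-nonZero (ℤ.+<+ (ℕ.s≤s ℕ.z≤n))
  equation : ∀ u v → dot2 (apply σ u) (apply σ v) * D ≡ n * dot2 u v
  equation u v = cross-multiply (dot2 (apply σ u) (apply σ v)) (dot2 u v) c (preserves u v)
  2NxD≡2n : + 2 * normSq x * D ≡ n * + 2
  2NxD≡2n = trans (cong (λ z → z * D) (sym (trans (cong₂ dot2 (apply-1E σ) (apply-1E σ)) (dot2-self x)))) (equation 1E 1E)
  2NyD≡2n : + 2 * normSq y * D ≡ n * + 2
  2NyD≡2n = trans (cong (λ z → z * D) (sym (trans (cong₂ dot2 (apply-ωE σ) (apply-ωE σ)) (dot2-self y)))) (equation ωE ωE)
  dotD≡-n : dot2 x y * D ≡ n * -1ℤ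
  dotD≡-n = trans (cong (λ z → z * D) (sym (cong₂ dot2 (apply-1E σ) (apply-ωE σ)))) (equation 1E ωE)
  Ny≡Nx : normSq y ≡ normSq x
  Ny≡Nx = ℤ.*-cancelˡ-≡ (+ 2) _ _ (ℤ.*-cancelʳ-≡ _ _ D (trans 2NyD≡2n (sym 2NxD≡2n)))
  dot≡-N : dot2 x y + normSq x ≡ 0ℤ
  dot≡-N = ℤ.*-cancelʳ-≡ _ 0ℤ (+ 2 * D) (begin
    (dot2 x y + normSq x) * (+ 2 * D)            ≡⟨ distribute (dot2 x y) (normSq x) D ⟩
    + 2 * (dot2 x y * D) + + 2 * normSq x * D    ≡⟨ cong₂ (λ s t → + 2 * s + t) dotD≡-n 2NxD≡2n ⟩
    + 2 * (n * -1ℤ) + n * + 2                    ≡⟨ cancel n ⟩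
    0ℤ                                           ∎)
    where
    open ≡-Reasoning
    distribute : ∀ d N D → (d + N) * (+ 2 * D) ≡ + 2 * (d * D) + + 2 * N * D
    distribute = solve-∀
    cancel : ∀ n → + 2 * (n * -1ℤ) + n * + 2 ≡ 0ℤ
    cancel = solve-∀
  x≢0 : x ≢ 0E
  x≢0 refl = ℤ.<-irrefl (sym (ℤ.*-cancelʳ-≡ n 0ℤ (+ 2) (sym 2NxD≡2n))) (0<↥ 0<c)
  image≐ : y ≡ x ⊗ ωE ⊎ y ≡ x ⊗ ω² → image σ ≐ mulLattice x
  image≐ (inj₁ y≡xω) = subst (λ y → image (x , y) ≐ mulLattice x) (sym y≡xω) (image-rotation x)
  image≐ (inj₂ y≡xω²) = subst (λ y → image (x , y) ≐ mulLattice x) (sym y≡xω²) (image-reflection x)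

-- Norms of elements of ℤ[ω]

Centred : ℕ → ℤ → Set
Centred M r = - (+ M) ≤ + 2 * r × + 2 * r ≤ + M

private
  quotient-shift : ∀ K q M → (K + q * M) - M * (q + 1ℤ) ≡ K - M
  quotient-shift = solve-∀

  quotient-cancel : ∀ K q M → (K + q * M) - M * q ≡ K
  quotient-cancel = solve-∀

  lower-slack : ∀ K M → + 2 * (K - M) - - M ≡ + 2 * K - M
  lower-slack = solve-∀

  upper-slack : ∀ K M → M - + 2 * (K - M) ≡ + 3 * (M - K) + K
  upper-slack = solve-∀

centred-residue : ∀ x M .{{_ : ℕ.NonZero M}} → ∃ λ q → Centred M (x - + M * q)
centred-residue x M = choose (2 ℕ.* k ℕ.≤? M)
  where
  k = x %ℕ M
  q = x /ℕ M
  x≡k+qM : x ≡ + k + q * + M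
  x≡k+qM = a≡a%ℕn+[a/ℕn]*n x M
  choose : Dec (2 ℕ.* k ℕ.≤ M) → ∃ λ q → Centred M (x - + M * q)
  choose (yes 2k≤M) = q , subst (Centred M) (sym (trans (cong (λ x → x - + M * q) x≡k+qM) (quotient-cancel (+ k) q (+ M))))
    (ℤ.≤-trans (ℤ.neg-mono-≤ (ℤ.+≤+ ℕ.z≤n)) (*-nonNeg {+ 2} {+ k} (ℤ.+≤+ ℕ.z≤n) (ℤ.+≤+ ℕ.z≤n)) ,
     subst (_≤ + M) (ℤ.pos-* 2 k) (ℤ.+≤+ 2k≤M))
  choose (no 2k≰M) = q + 1ℤ , subst (Centred M) (sym (trans (cong (λ x → x - + M * (q + 1ℤ)) x≡k+qM) (quotient-shift (+ k) q (+ M))))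
    (≤-by-difference (ℤ.i≤j⇒0≤j-i (subst (+ M ≤_) (ℤ.pos-* 2 k) (ℤ.+≤+ (ℕ.<⇒≤ (ℕ.≰⇒> 2k≰M))))) (lower-slack (+ k) (+ M)) ,
     ≤-by-difference (+-nonNeg (*-nonNeg {+ 3} (ℤ.+≤+ ℕ.z≤n) (ℤ.i≤j⇒0≤j-i (ℤ.+≤+ (ℕ.<⇒≤ (n%ℕd<d x M))))) (ℤ.+≤+ ℕ.z≤n))
       (upper-slack (+ k) (+ M)))

Small : ℕ → Eis → Set
Small M ρ = Centred M (re ρ) × Centred M (im ρ)

reduce : ∀ α M .{{_ : ℕ.NonZero M}} → ∃ λ κ → Small M (α ⊖ ((+ M) · κ))
reduce (a , b) M =
  let (q₁ , centred₁) = centred-residue a M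
      (q₂ , centred₂) = centred-residue b M
  in (q₁ , q₂) , centred₁ , centred₂

private
  small-slack : ∀ M r₁ r₂ → + 2 * (+ 3 * (M * M) - + 4 * normSq (r₁ , r₂)) ≡
    + 2 * ((M - + 2 * r₁) * (+ 2 * r₁ - - M)) + + 2 * ((M - + 2 * r₂) * (+ 2 * r₂ - - M)) +
    ((+ 2 * r₁ - - M) * (+ 2 * r₂ - - M) + (M - + 2 * r₁) * (M - + 2 * r₂))
  small-slack M r₁ r₂ = Poly.solve 3 (λ M r₁ r₂ →
    con (+ 2) :* (con (+ 3) :* (M :* M) :- con (+ 4) :* normSqᴾ (r₁ , r₂)) :=
    con (+ 2) :* ((M :- con (+ 2) :* r₁) :* (con (+ 2) :* r₁ :- :- M)) :+ con (+ 2) :* ((M :- con (+ 2) :* r₂) :* (con (+ 2) :* r₂ :- :- M)) :+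
    ((con (+ 2) :* r₁ :- :- M) :* (con (+ 2) :* r₂ :- :- M) :+ (M :- con (+ 2) :* r₁) :* (M :- con (+ 2) :* r₂))) refl M r₁ r₂

small-normSq : ∀ M ρ → Small M ρ → + 4 * normSq ρ ≤ + 3 * (+ M * + M)
small-normSq M (r₁ , r₂) ((-M≤2r₁ , 2r₁≤M) , (-M≤2r₂ , 2r₂≤M)) =
  ℤ.0≤i-j⇒j≤i (ℤ.*-cancelˡ-≤-pos 0ℤ _ (+ 2) (subst (0ℤ ≤_) (sym (small-slack (+ M) r₁ r₂))
    (+-nonNeg (+-nonNeg (*-nonNeg {+ 2} (ℤ.+≤+ ℕ.z≤n) (*-nonNeg u₁ l₁)) (*-nonNeg {+ 2} (ℤ.+≤+ ℕ.z≤n) (*-nonNeg u₂ l₂)))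
              (+-nonNeg (*-nonNeg l₁ l₂) (*-nonNeg u₁ u₂)))))
  where
  l₁ = ℤ.i≤j⇒0≤j-i -M≤2r₁
  u₁ = ℤ.i≤j⇒0≤j-i 2r₁≤M
  l₂ = ℤ.i≤j⇒0≤j-i -M≤2r₂
  u₂ = ℤ.i≤j⇒0≤j-i 2r₂≤M

private
  normSq-shift : ∀ α M κ → normSq (α ⊖ (M · κ)) ≡ normSq α - M * (dot2 α κ - M * normSq κ)
  normSq-shift (a , b) M (c , d) =
    Poly.solve 5 (λ a b M c d →
        normSqᴾ ((a , b) ⊖ᴾ M ·ᴾ (c , d)) :=
        normSqᴾ (a , b) :- M :* (dot2ᴾ (a , b) (c , d) :- M :* normSqᴾ (c , d))) refl a b M c d

  4kM≡ : ∀ k M → + 4 * (k * M) ≡ (+ 4 * k) * M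
  4kM≡ = solve-∀

  3MM≡ : ∀ M → + 3 * (M * M) ≡ (+ 3 * M) * M
  3MM≡ = solve-∀

  3M<4M : ∀ {M} → 0ℤ ℤ.< M → + 3 * M ℤ.< + 4 * M
  3M<4M {M} 0<M = subst₂ ℤ._<_ (ℤ.+-identityʳ (+ 3 * M)) (3M+M M) (ℤ.+-monoʳ-< (+ 3 * M) 0<M)
    where
    3M+M : ∀ M → + 3 * M + M ≡ + 4 * M
    3M+M = solve-∀

small-representative : ∀ M α .{{_ : ℕ.NonZero M}} → + M ∣ normSq α → ¬ ((+ M) ∣ᴱ α) →
  ∃₂ λ κ m → normSq (α ⊖ ((+ M) · κ)) ≡ + m * + M × 0 ℕ.< m × m ℕ.< M
small-representative M α M∣Nα M∤α = κ , quotient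
  where
  κ = proj₁ (reduce α M)
  ρ = α ⊖ ((+ M) · κ)
  0<M : 0ℤ ℤ.< + M
  0<M = ℤ.+<+ (ℕ.>-nonZero⁻¹ M)
  ρ≢0 : ρ ≢ 0E
  ρ≢0 ρ≡0 = M∤α (subst ((+ M) ∣ᴱ_) (sym (⊖≡0E⇒≡ α ((+ M) · κ) ρ≡0)) (∣ᴱ-· (+ M) κ))
  M∣Nρ : + M ∣ normSq ρ
  M∣Nρ = subst (+ M ∣_) (sym (normSq-shift α (+ M) κ)) (∣m∣n⇒∣m-n M∣Nα (∣m⇒∣m*n _ ∣-refl))
  instance
    _ = ℤ.positive 0<M
  quotient : ∃ λ m → normSq ρ ≡ + m * + M × 0 ℕ.< m × m ℕ.< M
  quotient = from-divides M∣Nρ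
    where
    from-positive : ∀ k → normSq ρ ≡ k * + M → 0ℤ ℤ.< k → ∃ λ m → normSq ρ ≡ + m * + M × 0 ℕ.< m × m ℕ.< M
    from-positive (+ m) Nρ≡mM (ℤ.+<+ 0<m) = m , Nρ≡mM , 0<m , m<M
      where
      4m≤3M : + 4 * + m ≤ + 3 * + M
      4m≤3M = ℤ.*-cancelʳ-≤-pos (+ 4 * + m) (+ 3 * + M) (+ M)
        (subst₂ _≤_ (trans (cong (+ 4 *_) Nρ≡mM) (4kM≡ (+ m) (+ M))) (3MM≡ (+ M)) (small-normSq M ρ (proj₂ (reduce α M))))
      m<M : m ℕ.< M
      m<M = ℤ.drop‿+<+ (ℤ.*-cancelˡ-<-nonNeg (+ 4) (ℤ.≤-<-trans 4m≤3M (3M<4M 0<M)))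
    from-divides : + M ∣ normSq ρ → ∃ λ m → normSq ρ ≡ + m * + M × 0 ℕ.< m × m ℕ.< M
    from-divides (divides k Nρ≡kM) =
      from-positive k Nρ≡kM (ℤ.*-cancelʳ-<-nonNeg {0ℤ} {k} (+ M) (subst (0ℤ ℤ.<_) Nρ≡kM (normSq-pos ρ≢0)))

private
  descent-identity : ∀ α κ M → α ⊗ conj (α ⊖ (M · κ)) ≡
                     (normSq (α ⊖ (M · κ)) , 0ℤ) ⊕ (M · (κ ⊗ conj (α ⊖ (M · κ))))
  descent-identity (a , b) (c , d) M = cong₂ _,_
    (Poly.solve 5 (λ a b c d M → let ρ = (a , b) ⊖ᴾ M ·ᴾ (c , d) in
      proj₁ ((a , b) ⊗ᴾ conjᴾ ρ) := normSqᴾ ρ :+ proj₁ (M ·ᴾ ((c , d) ⊗ᴾ conjᴾ ρ))) refl a b c d M)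
    (Poly.solve 5 (λ a b c d M → let ρ = (a , b) ⊖ᴾ M ·ᴾ (c , d) in
      proj₂ ((a , b) ⊗ᴾ conjᴾ ρ) := con 0ℤ :+ proj₂ (M ·ᴾ ((c , d) ⊗ᴾ conjᴾ ρ))) refl a b c d M)

  factor-out : ∀ m M z → (m * M , 0ℤ) ⊕ (M · z) ≡ M · ((m , 0ℤ) ⊕ z)
  factor-out m M (c , d) = cong₂ _,_
    (Poly.solve 4 (λ m M c d → m :* M :+ proj₁ (M ·ᴾ (c , d)) := proj₁ (M ·ᴾ ((m , con 0ℤ) ⊕ᴾ (c , d)))) refl m M c d)
    (Poly.solve 4 (λ m M c d → con 0ℤ :+ proj₂ (M ·ᴾ (c , d)) := proj₂ (M ·ᴾ ((m , con 0ℤ) ⊕ᴾ (c , d)))) refl m M c d)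

  rearrange : ∀ M p m → (M * p) * (m * M) ≡ M * (M * (m * p))
  rearrange = solve-∀

  multiple-of-proper-divisor : ∀ {M p} → Prime p → 2 ℕ.≤ M → M ℕ.< p → ¬ ((+ M) ∣ + p)
  multiple-of-proper-divisor prime-p 2≤M M<p M∣p = Sum.[ (λ { refl → contradiction 2≤M λ { (ℕ.s≤s ()) } }) ,
    (λ { refl → ℕ.<-irrefl refl M<p }) ]′ (prime⇒irreducible prime-p (∣⇒∣ᵤ M∣p))

-- γ = α ρ̄ / M for the centred representative ρ of α modulo M.
descent-step : ∀ {p} M α → Prime p → 2 ℕ.≤ M → M ℕ.< p → normSq α ≡ + M * + p →
               ∃₂ λ γ m → normSq γ ≡ + m * + p × 0 ℕ.< m × m ℕ.< M
descent-step {p} M@(suc _) α prime-p 2≤M M<p Nα≡Mp = descend (small-representative M α M∣Nα M∤α)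
  where
  open ≡-Reasoning
  descend : (∃₂ λ κ m → normSq (α ⊖ ((+ M) · κ)) ≡ + m * + M × 0 ℕ.< m × m ℕ.< M) →
            ∃₂ λ γ m → normSq γ ≡ + m * + p × 0 ℕ.< m × m ℕ.< M
  descend (κ , m , Nρ≡mM , 0<m , m<M) = γ , m , Nγ≡mp , 0<m , m<M
    where
    ρ = α ⊖ ((+ M) · κ)
    γ = (+ m , 0ℤ) ⊕ (κ ⊗ conj ρ)
    αρ̄≡Mγ : α ⊗ conj ρ ≡ (+ M) · γ
    αρ̄≡Mγ = begin
      α ⊗ conj ρ                                    ≡⟨ descent-identity α κ (+ M) ⟩
      (normSq ρ , 0ℤ) ⊕ ((+ M) · (κ ⊗ conj ρ))      ≡⟨ cong (λ N → (N , 0ℤ) ⊕ ((+ M) · (κ ⊗ conj ρ))) Nρ≡mM ⟩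
      (+ m * + M , 0ℤ) ⊕ ((+ M) · (κ ⊗ conj ρ))     ≡⟨ factor-out (+ m) (+ M) (κ ⊗ conj ρ) ⟩
      (+ M) · γ                                     ∎
    M²Nγ≡M²mp : + M * (+ M * normSq γ) ≡ + M * (+ M * (+ m * + p))
    M²Nγ≡M²mp = begin
      + M * (+ M * normSq γ)      ≡⟨ normSq-· (+ M) γ ⟨
      normSq ((+ M) · γ)          ≡⟨ cong normSq αρ̄≡Mγ ⟨
      normSq (α ⊗ conj ρ)         ≡⟨ normSq-⊗ α (conj ρ) ⟩
      normSq α * normSq (conj ρ)  ≡⟨ cong₂ _*_ Nα≡Mp (trans (normSq-conj ρ) Nρ≡mM) ⟩
      (+ M * + p) * (+ m * + M)   ≡⟨ rearrange (+ M) (+ p) (+ m) ⟩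
      + M * (+ M * (+ m * + p))   ∎
    Nγ≡mp : normSq γ ≡ + m * + p
    Nγ≡mp = ℤ.*-cancelˡ-≡ (+ M) (normSq γ) (+ m * + p)
      (ℤ.*-cancelˡ-≡ (+ M) (+ M * normSq γ) (+ M * (+ m * + p)) M²Nγ≡M²mp)
  M∣Nα : (+ M) ∣ normSq α
  M∣Nα = subst ((+ M) ∣_) (sym Nα≡Mp) (∣m⇒∣m*n (+ p) ∣-refl)
  M∤α : ¬ ((+ M) ∣ᴱ α)
  M∤α M∣α = let (α′ , α≡Mα′) = ∣ᴱ⇒· α M∣α
            in multiple-of-proper-divisor prime-p 2≤M M<p (norm-of-multiple α′ (trans (cong normSq (sym α≡Mα′)) Nα≡Mp))
    where
    norm-of-multiple : ∀ α′ → normSq ((+ M) · α′) ≡ + M * + p → (+ M) ∣ + p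
    norm-of-multiple α′ N≡Mp = divides (normSq α′) (trans (sym (ℤ.*-cancelˡ-≡ (+ M) (+ M * normSq α′) (+ p)
      (trans (sym (normSq-· (+ M) α′)) N≡Mp))) (ℤ.*-comm (+ M) (normSq α′)))

norm-descent : ∀ {p} → Prime p → ∀ m → Acc ℕ._<_ m → ∀ α → normSq α ≡ + m * + p → 0 ℕ.< m → m ℕ.< p →
               ∃ λ π → normSq π ≡ + p
norm-descent prime-p 1 _ α Nα≡p _ _ = α , trans Nα≡p (ℤ.*-identityˡ _)
norm-descent {p} prime-p m@(suc (suc _)) (acc smaller) α Nα≡mp _ m<p =
  descend (descent-step m α prime-p (ℕ.s≤s (ℕ.s≤s ℕ.z≤n)) m<p Nα≡mp)
  where
  descend : (∃₂ λ γ m′ → normSq γ ≡ + m′ * + p × 0 ℕ.< m′ × m′ ℕ.< m) → ∃ λ π → normSq π ≡ + p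
  descend (γ , m′ , Nγ≡m′p , 0<m′ , m′<m) = norm-descent prime-p m′ (smaller m′<m) γ Nγ≡m′p 0<m′ (ℕ.<-trans m′<m m<p)

prime-norm : ∀ {p} → Prime p → ∀ α → (+ p) ∣ normSq α → ¬ ((+ p) ∣ᴱ α) → ∃ λ π → normSq π ≡ + p
prime-norm {p} prime-p α p∣Nα p∤α = start (small-representative p α {{prime⇒nonZero prime-p}} p∣Nα p∤α)
  where
  start : (∃₂ λ κ m → normSq (α ⊖ ((+ p) · κ)) ≡ + m * + p × 0 ℕ.< m × m ℕ.< p) → ∃ λ π → normSq π ≡ + p
  start (κ , m , Nρ≡mp , 0<m , m<p) = norm-descent prime-p m (<-wellFounded m) (α ⊖ ((+ p) · κ)) Nρ≡mp 0<m m<p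

private
  square-mod-3 : ∀ s → ∃ λ k → s * s ≡ + 3 * k ⊎ s * s ≡ + 3 * k + 1ℤ
  square-mod-3 s = subst (λ s → ∃ λ k → s * s ≡ + 3 * k ⊎ s * s ≡ + 3 * k + 1ℤ) (sym (a≡a%ℕn+[a/ℕn]*n s 3))
    (by-residue (s /ℕ 3) (s %ℕ 3) (n%ℕd<d s 3))
    where
    by-residue : ∀ q r → r ℕ.< 3 → ∃ λ k → (+ r + q * + 3) * (+ r + q * + 3) ≡ + 3 * k ⊎
                                           (+ r + q * + 3) * (+ r + q * + 3) ≡ + 3 * k + 1ℤ
    by-residue q 0 _ = + 3 * (q * q) , inj₁ (solve (q ∷ []))
    by-residue q 1 _ = + 2 * q + + 3 * (q * q) , inj₂ (solve (q ∷ []))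
    by-residue q 2 _ = 1ℤ + + 4 * q + + 3 * (q * q) , inj₂ (solve (q ∷ []))
    by-residue q (suc (suc (suc _))) (ℕ.s≤s (ℕ.s≤s (ℕ.s≤s ())))

  normSq-as-square : ∀ x y → normSq (x , y) ≡ (x + y) * (x + y) - + 3 * (x * y)
  normSq-as-square x y = Poly.solve 2 (λ x y → normSqᴾ (x , y) := (x :+ y) :* (x :+ y) :- con (+ 3) :* (x :* y)) refl x y

  3k-3xy : ∀ k xy → + 3 * k - + 3 * xy ≡ + 3 * (k - xy)
  3k-3xy = solve-∀

  3k+1-3xy : ∀ k xy → (+ 3 * k + 1ℤ) - + 3 * xy ≡ + 3 * (k - xy) + 1ℤ
  3k+1-3xy = solve-∀

  negative-3k+1 : ∀ K → + 3 * (- (1ℤ + K)) + 1ℤ ≡ - (+ 2 + + 3 * K)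
  negative-3k+1 = solve-∀

  ≡3K+1⇒%3≡1 : ∀ {p} K → + p ≡ + 3 * K + 1ℤ → p % 3 ≡ 1
  ≡3K+1⇒%3≡1 {p} (+ k) p≡3k+1 = begin
    p % 3             ≡⟨ cong (_% 3) (ℤ.+-injective (trans p≡3k+1 (cong (_+ 1ℤ) (sym (ℤ.pos-* 3 k))))) ⟩
    (3 ℕ.* k ℕ.+ 1) % 3 ≡⟨ cong (_% 3) (trans (ℕ.+-comm (3 ℕ.* k) 1) (cong suc (ℕ.*-comm 3 k))) ⟩
    (1 ℕ.+ k ℕ.* 3) % 3 ≡⟨ ℕ.[m+kn]%n≡m%n 1 k 3 ⟩
    1                 ∎
    where open ≡-Reasoning
  ≡3K+1⇒%3≡1 {p} -[1+ k ] p≡3K+1 = contradiction (subst (0ℤ ≤_) (trans p≡3K+1 (negative-3k+1 (+ k))) (ℤ.+≤+ ℕ.z≤n))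
    (ℤ.<⇒≱ (ℤ.neg-mono-< (ℤ.+-mono-<-≤ (ℤ.+<+ (ℕ.s≤s ℕ.z≤n)) (*-nonNeg {+ 3} {+ k} (ℤ.+≤+ ℕ.z≤n) (ℤ.+≤+ ℕ.z≤n)))))

-- x² − xy + y² = (x + y)² − 3xy and squares are 0 or 1 modulo 3.
normSq-prime-mod-3 : ∀ π {p} → Prime p → normSq π ≡ + p → p ≡ 3 ⊎ p % 3 ≡ 1
normSq-prime-mod-3 (x , y) {p} prime-p N≡p = by-square (square-mod-3 (x + y))
  where
  p≡ : + p ≡ (x + y) * (x + y) - + 3 * (x * y)
  p≡ = trans (sym N≡p) (normSq-as-square x y)
  by-square : (∃ λ k → (x + y) * (x + y) ≡ + 3 * k ⊎ (x + y) * (x + y) ≡ + 3 * k + 1ℤ) → p ≡ 3 ⊎ p % 3 ≡ 1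
  by-square (k , inj₁ s²≡3k) = inj₁ (sym (prime-∣-prime prime-p prime[3] (divides (k - x * y)
    (trans p≡ (trans (cong (λ s² → s² - + 3 * (x * y)) s²≡3k) (trans (3k-3xy k (x * y)) (ℤ.*-comm (+ 3) (k - x * y))))))))
  by-square (k , inj₂ s²≡3k+1) = inj₂ (≡3K+1⇒%3≡1 (k - x * y)
    (trans p≡ (trans (cong (λ s² → s² - + 3 * (x * y)) s²≡3k+1) (3k+1-3xy k (x * y)))))

private
  ∣ᴱ-⊕ : ∀ {k} x y → k ∣ᴱ x → k ∣ᴱ y → k ∣ᴱ x ⊕ y
  ∣ᴱ-⊕ (a , b) (c , d) (k∣a , k∣b) (k∣c , k∣d) = ∣m∣n⇒∣m+n k∣a k∣c , ∣m∣n⇒∣m+n k∣b k∣d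

  ⊗-conj-⊗ : ∀ α π → (α ⊗ π) ⊗ conj π ≡ normSq π · α
  ⊗-conj-⊗ (a , b) (c , d) = cong₂ _,_
    (Poly.solve 4 (λ a b c d → proj₁ (((a , b) ⊗ᴾ (c , d)) ⊗ᴾ conjᴾ (c , d)) := proj₁ (normSqᴾ (c , d) ·ᴾ (a , b))) refl a b c d)
    (Poly.solve 4 (λ a b c d → proj₂ (((a , b) ⊗ᴾ (c , d)) ⊗ᴾ conjᴾ (c , d)) := proj₂ (normSqᴾ (c , d) ·ᴾ (a , b))) refl a b c d)

  trace-identity : ∀ α π → (α ⊗ π) ⊕ (α ⊗ conj π) ≡ (+ 2 * re π - im π) · α
  trace-identity (a , b) (c , d) = cong₂ _,_
    (Poly.solve 4 (λ a b c d →
        proj₁ ((a , b) ⊗ᴾ (c , d) ⊕ᴾ (a , b) ⊗ᴾ conjᴾ (c , d)) :=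
        proj₁ ((con (+ 2) :* c :- d) ·ᴾ (a , b))) refl a b c d)
    (Poly.solve 4 (λ a b c d →
        proj₂ ((a , b) ⊗ᴾ (c , d) ⊕ᴾ (a , b) ⊗ᴾ conjᴾ (c , d)) :=
        proj₂ ((con (+ 2) :* c :- d) ·ᴾ (a , b))) refl a b c d)

-- (α π) π̄ = N(π) α
prime-∣ᴱ-⊗⇒∣normSq : ∀ {q} α π → Primitive α → + q ∣ᴱ α ⊗ π → + q ∣ normSq π
prime-∣ᴱ-⊗⇒∣normSq α π prim q∣απ = primitive-∣ᴱ-· prim (subst (_ ∣ᴱ_) (⊗-conj-⊗ α π) (∣ᴱ-⊗ʳ (α ⊗ π) (conj π) q∣απ))

private
  four-normSq-y : ∀ x y → + 3 * (y * y) ≡ + 4 * normSq (x , y) - (+ 2 * x - y) * (+ 2 * x - y)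
  four-normSq-y x y = Poly.solve 2 (λ x y →
      con (+ 3) :* (y :* y) :=
      con (+ 4) :* normSqᴾ (x , y) :- (con (+ 2) :* x :- y) :* (con (+ 2) :* x :- y)) refl x y

  2x≡ : ∀ x y → + 2 * x ≡ (+ 2 * x - y) + y
  2x≡ = solve-∀

prime-norm⇒prime∤ᴱ : ∀ π {p} → Prime p → normSq π ≡ + p → ¬ ((+ p) ∣ᴱ π)
prime-norm⇒prime∤ᴱ π {p} prime-p Nπ≡p p∣π =
  let (π′ , π≡pπ′) = ∣ᴱ⇒· π p∣π
  in prime∤1 prime-p (divides (normSq π′) (sym (trans (ℤ.*-comm (normSq π′) (+ p))
       (ℤ.*-cancelˡ-≡ (+ p) (+ p * normSq π′) 1ℤ {{prime⇒nonZero prime-p}}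
         (trans (sym (normSq-· (+ p) π′)) (trans (cong normSq (sym π≡pπ′)) (trans Nπ≡p (sym (ℤ.*-identityʳ (+ p))))))))))

-- 4 N(π) = T² + 3 y² for π = x + y ω and T = 2x − y, so p ∣ T would give p ∣ 3y², hence p ∣ y, p ∣ 2x and p ∣ᴱ π.
prime-norm-∤-trace : ∀ π {p} → Prime p → p % 3 ≡ 1 → normSq π ≡ + p → ¬ ((+ p) ∣ + 2 * re π - im π)
prime-norm-∤-trace π@(x , y) {p} prime-p p%3≡1 Nπ≡p p∣T =
  Sum.[ (λ p∣3 → p≢ prime[3] p∣3 λ ()) , (λ p∣y² → Sum.[ from-y , from-y ]′ (prime-∣-* y y prime-p p∣y²)) ]′
    (prime-∣-* (+ 3) (y * y) prime-p p∣3y²)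
  where
  p≢ : ∀ {q} → Prime q → (+ p) ∣ + q → q % 3 ≢ 1 → ⊥
  p≢ prime-q p∣q q%3≢1 = q%3≢1 (subst (λ p → p % 3 ≡ 1) (prime-∣-prime prime-q prime-p p∣q) p%3≡1)
  p∣3y² : (+ p) ∣ + 3 * (y * y)
  p∣3y² = subst ((+ p) ∣_) (sym (four-normSq-y x y))
    (∣m∣n⇒∣m-n (∣n⇒∣m*n (+ 4) (subst ((+ p) ∣_) (sym Nπ≡p) ∣-refl)) (∣m⇒∣m*n _ p∣T))
  from-y : (+ p) ∣ y → ⊥
  from-y p∣y = Sum.[ (λ p∣2 → p≢ prime[2] p∣2 λ ()) , (λ p∣x → prime-norm⇒prime∤ᴱ π prime-p Nπ≡p (p∣x , p∣y)) ]′
    (prime-∣-* (+ 2) x prime-p (subst ((+ p) ∣_) (sym (2x≡ x y)) (∣m∣n⇒∣m+n p∣T p∣y)))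

-- A prime dividing α π divides N(π) = p; were α π and α π̄ both imprimitive, p would divide
-- α π + α π̄ = T α and hence the trace T.
primitive-product : ∀ α π {p} → Primitive α → Prime p → p % 3 ≡ 1 → normSq π ≡ + p →
                    Primitive (α ⊗ π) ⊎ Primitive (α ⊗ conj π)
primitive-product α π {p} prim prime-p p%3≡1 Nπ≡p = choose (primitive? (α ⊗ π)) (primitive? (α ⊗ conj π))
  where
  p∣ᴱ : ∀ π′ → normSq π′ ≡ + p → ¬ Primitive (α ⊗ π′) → (+ p) ∣ᴱ α ⊗ π′
  p∣ᴱ π′ Nπ′≡p ¬prim = divisor (¬primitive⇒prime-∣ᴱ (α ⊗ π′) απ′≢0 ¬prim)
    where
    απ′≢0 : α ⊗ π′ ≢ 0E
    απ′≢0 απ′≡0 = Sum.[ primitive⇒≢0E prim ,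
      (λ π′≡0 → ¬prime[0] (subst Prime (ℤ.+-injective (trans (sym Nπ′≡p) (cong normSq π′≡0))) prime-p)) ]′
      (⊗-zero-divisor α π′ απ′≡0)
    divisor : (∃ λ q → Prime q × (+ q) ∣ᴱ α ⊗ π′) → (+ p) ∣ᴱ α ⊗ π′
    divisor (q , prime-q , q∣απ′) = subst (λ q → (+ q) ∣ᴱ α ⊗ π′)
      (prime-∣-prime prime-p prime-q (subst ((+ q) ∣_) Nπ′≡p (prime-∣ᴱ-⊗⇒∣normSq α π′ prim q∣απ′))) q∣απ′
  choose : Dec (Primitive (α ⊗ π)) → Dec (Primitive (α ⊗ conj π)) → Primitive (α ⊗ π) ⊎ Primitive (α ⊗ conj π)
  choose (yes prim₁) _ = inj₁ prim₁
  choose (no _) (yes prim₂) = inj₂ prim₂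
  choose (no ¬prim₁) (no ¬prim₂) = contradiction
    (primitive-∣ᴱ-· prim (subst ((+ p) ∣ᴱ_) (trace-identity α π)
      (∣ᴱ-⊕ (α ⊗ π) (α ⊗ conj π) (p∣ᴱ π Nπ≡p ¬prim₁) (p∣ᴱ (conj π) (trans (normSq-conj π) Nπ≡p) ¬prim₂))))
    (prime-norm-∤-trace π prime-p p%3≡1 Nπ≡p)

private
  square-of-sum : ∀ a b → (a + b) * (a + b) ≡ normSq (a , b) + + 3 * (a * b)
  square-of-sum a b = Poly.solve 2 (λ a b → (a :+ b) :* (a :+ b) := normSqᴾ (a , b) :+ con (+ 3) :* (a :* b)) refl a b

  re-⊗θ : ∀ a b → re ((a , b) ⊗ θ) ≡ (a + b) - + 3 * b
  re-⊗θ a b = Poly.solve 2 (λ a b → proj₁ ((a , b) ⊗ᴾ ⟨ θ ⟩ᴾ) := (a :+ b) :- con (+ 3) :* b) refl a b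

  im-⊗θ : ∀ a b → im ((a , b) ⊗ θ) ≡ + 2 * (a + b) - + 3 * b
  im-⊗θ a b = Poly.solve 2 (λ a b → proj₂ ((a , b) ⊗ᴾ ⟨ θ ⟩ᴾ) := con (+ 2) :* (a :+ b) :- con (+ 3) :* b) refl a b

3∣normSq⇒3∣ᴱ-⊗θ : ∀ α → (+ 3) ∣ normSq α → (+ 3) ∣ᴱ α ⊗ θ
3∣normSq⇒3∣ᴱ-⊗θ (a , b) 3∣N =
  subst ((+ 3) ∣_) (sym (re-⊗θ a b)) (∣m∣n⇒∣m-n 3∣a+b (∣m⇒∣m*n b ∣-refl)) ,
  subst ((+ 3) ∣_) (sym (im-⊗θ a b)) (∣m∣n⇒∣m-n (∣n⇒∣m*n (+ 2) 3∣a+b) (∣m⇒∣m*n b ∣-refl))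
  where
  3∣a+b : (+ 3) ∣ a + b
  3∣a+b = Sum.[ (λ d → d) , (λ d → d) ]′ (prime-∣-* (a + b) (a + b) prime[3]
    (subst ((+ 3) ∣_) (sym (square-of-sum a b)) (∣m∣n⇒∣m+n 3∣N (∣m⇒∣m*n (a * b) ∣-refl))))

primitive-θ⇔ : ∀ α → Primitive (α ⊗ θ) ⇔ (Primitive α × ¬ ((+ 3) ∣ normSq α))
primitive-θ⇔ α = mk⇔
  (λ prim → primitive-⊗ˡ α θ prim , primitive⇒prime∤ᴱ prim prime[3] ∘ 3∣normSq⇒3∣ᴱ-⊗θ α)
  (λ { (prim , 3∤N) → primitive-by-primes (α ⊗ θ)
         (λ αθ≡0 → Sum.[ primitive⇒≢0E prim , (λ ()) ]′ (⊗-zero-divisor α θ αθ≡0))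
         (λ prime-q q∣αθ → Sum.[ (λ { (ρ , α≡θρ) → 3∤N (3∣normSq-θ-multiple ρ α≡θρ) }) , primitive⇒prime∤ᴱ prim prime-q ]′
           (θ-prime-divisor α prime-q q∣αθ)) })
  where
  3∣normSq-θ-multiple : ∀ ρ → α ≡ θ ⊗ ρ → (+ 3) ∣ normSq α
  3∣normSq-θ-multiple ρ α≡θρ = divides (normSq ρ) (trans (cong normSq α≡θρ) (trans (normSq-⊗ θ ρ) (ℤ.*-comm (+ 3) (normSq ρ))))

norm-is-product : ∀ α → Primitive α → ¬ ((+ 3) ∣ normSq α) → ProductOfPrimes1mod3 ℤ.∣ normSq α ∣
norm-is-product α prim 3∤N = factors , all-≡1 factors (ℕ.∣-reflexive (sym isFactorisation)) factorsPrime , sym isFactorisation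
  where
  N = ℤ.∣ normSq α ∣
  instance
    _ : ℕ.NonZero N
    _ = ℕ.≢-nonZero (λ N≡0 → primitive⇒≢0E prim (normSq≡0⇒≡0E α (ℤ.∣i∣≡0⇒i≡0 N≡0)))
  open PrimeFactorisation (factorise N)
  prime-factor-≡1 : ∀ {q} → Prime q → q ℕ.∣ N → q % 3 ≡ 1
  prime-factor-≡1 {q} prime-q q∣N = by-norm (prime-norm prime-q α q∣Nα (primitive⇒prime∤ᴱ prim prime-q))
    where
    q∣Nα : (+ q) ∣ normSq α
    q∣Nα = ∣ᵤ⇒∣ q∣N
    by-norm : (∃ λ π → normSq π ≡ + q) → q % 3 ≡ 1
    by-norm (π , Nπ≡q) = Sum.[ (λ q≡3 → contradiction (subst (λ q → (+ q) ∣ normSq α) q≡3 q∣Nα) 3∤N) , (λ q%3≡1 → q%3≡1) ]′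
      (normSq-prime-mod-3 π prime-q Nπ≡q)
  all-≡1 : ∀ qs → product qs ℕ.∣ N → All Prime qs → All (λ q → Prime q × q % 3 ≡ 1) qs
  all-≡1 [] _ All.[] = All.[]
  all-≡1 (q ∷ qs) qqs∣N (prime-q All.∷ primes) =
    (prime-q , prime-factor-≡1 prime-q (ℕ.∣-trans (ℕ.m∣m*n (product qs)) qqs∣N)) All.∷
    all-≡1 qs (ℕ.∣-trans (ℕ.n∣m*n q) qqs∣N) primes

-- Sixth roots of unity modulo a prime

private
  least : ℕ → ℕ → ℕ → ℕ
  least x y z = if does (x <? y) ∧ does (x <? z) then 1 else 0

  least≡1 : ∀ {x y z} → x ℕ.< y → x ℕ.< z → least x y z ≡ 1
  least≡1 {x} {y} {z} x<y x<z rewrite dec-true (x <? y) x<y | dec-true (x <? z) x<z = refl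

  least≡0ˡ : ∀ {x y} z → y ℕ.< x → least x y z ≡ 0
  least≡0ˡ {x} {y} z y<x rewrite dec-false (x <? y) (ℕ.<-asym y<x) = refl

  least≡0ʳ : ∀ {x z} y → z ℕ.< x → least x y z ≡ 0
  least≡0ʳ {x} {z} y z<x rewrite dec-false (x <? z) (ℕ.<-asym z<x) | Bool.∧-zeroʳ (does (x <? y)) = refl

  1+0+0 : ∀ {i j k} → i ≡ 1 → j ≡ 0 → k ≡ 0 → i ℕ.+ j ℕ.+ k ≡ 1
  1+0+0 refl refl refl = refl

  0+1+0 : ∀ {i j k} → i ≡ 0 → j ≡ 1 → k ≡ 0 → i ℕ.+ j ℕ.+ k ≡ 1
  0+1+0 refl refl refl = refl

  0+0+1 : ∀ {i j k} → i ≡ 0 → j ≡ 0 → k ≡ 1 → i ℕ.+ j ℕ.+ k ≡ 1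
  0+0+1 refl refl refl = refl

  exactly-one-least : ∀ a b c → a ≢ b → b ≢ c → c ≢ a → least a b c ℕ.+ least b c a ℕ.+ least c a b ≡ 1
  exactly-one-least a b c a≢b b≢c c≢a with ℕ.<-cmp a b | ℕ.<-cmp b c | ℕ.<-cmp c a
  ... | tri≈ _ a≡b _ | _ | _ = contradiction a≡b a≢b
  ... | _ | tri≈ _ b≡c _ | _ = contradiction b≡c b≢c
  ... | _ | _ | tri≈ _ c≡a _ = contradiction c≡a c≢a
  ... | tri< a<b _ _ | tri< b<c _ _ | tri< c<a _ _ = contradiction (ℕ.<-trans a<b (ℕ.<-trans b<c c<a)) (ℕ.<-irrefl refl)
  ... | tri< a<b _ _ | tri< b<c _ _ | tri> _ _ a<c = 1+0+0 (least≡1 a<b a<c) (least≡0ʳ c a<b) (least≡0ˡ b a<c)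
  ... | tri< a<b _ _ | tri> _ _ c<b | tri< c<a _ _ = 0+0+1 (least≡0ʳ b c<a) (least≡0ˡ a c<b) (least≡1 c<a c<b)
  ... | tri< a<b _ _ | tri> _ _ c<b | tri> _ _ a<c = 1+0+0 (least≡1 a<b a<c) (least≡0ʳ c a<b) (least≡0ˡ b a<c)
  ... | tri> _ _ b<a | tri< b<c _ _ | tri< c<a _ _ = 0+1+0 (least≡0ˡ c b<a) (least≡1 b<c b<a) (least≡0ʳ a b<c)
  ... | tri> _ _ b<a | tri< b<c _ _ | tri> _ _ a<c = 0+1+0 (least≡0ˡ c b<a) (least≡1 b<c b<a) (least≡0ʳ a b<c)
  ... | tri> _ _ b<a | tri> _ _ c<b | tri< c<a _ _ = 0+0+1 (least≡0ʳ b c<a) (least≡0ˡ a c<b) (least≡1 c<a c<b)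
  ... | tri> _ _ b<a | tri> _ _ c<b | tri> _ _ a<c = contradiction (ℕ.<-trans b<a (ℕ.<-trans a<c c<b)) (ℕ.<-irrefl refl)

  sum-ones : ∀ n → sum {n} (λ _ → 1) ≡ n
  sum-ones zero = refl
  sum-ones (suc n) = cong suc (sum-ones n)

-- Counting each orbit {i, g i, g (g i)} through its least element.
order-3-orbits : ∀ n (g : Fin n → Fin n) → (∀ i → g (g (g i)) ≡ i) → (∀ i → g i ≢ i) → 3 ℕ.∣ n
order-3-orbits n g g³≡id no-fixed-point = ℕ.divides (sum h) n≡3Σh
  where
  h : Fin n → ℕ
  h i = least (toℕ i) (toℕ (g i)) (toℕ (g (g i)))
  ≢⇒toℕ≢ : ∀ {i j} → i ≢ j → toℕ i ≢ toℕ j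
  ≢⇒toℕ≢ i≢j = i≢j ∘ Fin.toℕ-injective
  orbit-sum : ∀ i → h i ℕ.+ h (g i) ℕ.+ h (g (g i)) ≡ 1
  orbit-sum i = begin
    h i ℕ.+ h (g i) ℕ.+ h (g (g i))
      ≡⟨ cong₂ (λ x y → h i ℕ.+ least (toℕ (g i)) (toℕ (g (g i))) (toℕ x) ℕ.+ least (toℕ (g (g i))) (toℕ x) (toℕ y))
               (g³≡id i) (cong g (g³≡id i)) ⟩
    least a b c ℕ.+ least b c a ℕ.+ least c a b
      ≡⟨ exactly-one-least a b c (≢⇒toℕ≢ (no-fixed-point i ∘ sym)) (≢⇒toℕ≢ (no-fixed-point (g i) ∘ sym))
           (≢⇒toℕ≢ (λ g²i≡i → no-fixed-point i (trans (cong g (sym g²i≡i)) (g³≡id i)))) ⟩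
    1 ∎
    where
    open ≡-Reasoning
    a = toℕ i
    b = toℕ (g i)
    c = toℕ (g (g i))
  π : Permutation n n
  π = permutation g (g ∘ g) g³≡id g³≡id
  n≡3Σh : n ≡ sum h ℕ.* 3
  n≡3Σh = begin
    n                                                     ≡⟨ sum-ones n ⟨
    sum {n} (λ _ → 1)                                     ≡⟨ sum-cong-≗ (sym ∘ orbit-sum) ⟩
    sum (λ i → h i ℕ.+ h (g i) ℕ.+ h (g (g i)))           ≡⟨ ∑-distrib-+ (λ i → h i ℕ.+ h (g i)) (h ∘ g ∘ g) ⟩
    sum (λ i → h i ℕ.+ h (g i)) ℕ.+ sum (h ∘ g ∘ g)       ≡⟨ cong (ℕ._+ sum (h ∘ g ∘ g)) (∑-distrib-+ h (h ∘ g)) ⟩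
    sum h ℕ.+ sum (h ∘ g) ℕ.+ sum (h ∘ g ∘ g)             ≡⟨ cong₂ (λ s t → sum h ℕ.+ s ℕ.+ t) (sum-permute h π) (trans (sum-permute h π) (sum-permute (h ∘ g) π)) ⟨
    sum h ℕ.+ sum h ℕ.+ sum h                             ≡⟨ three-copies (sum h) ⟩
    sum h ℕ.* 3                                           ∎
    where
    open ≡-Reasoning
    three-copies : ∀ s → s ℕ.+ s ℕ.+ s ≡ s ℕ.* 3
    three-copies s = trans (ℕ.+-assoc s s s) (trans (cong (λ t → s ℕ.+ (s ℕ.+ t)) (sym (ℕ.+-identityʳ s))) (ℕ.*-comm 3 s))

private
  step-identity : ∀ s u v q r P → s * r - (r - 1ℤ) ≡
    (v - q * r) * P + (1ℤ - (u * r + v * P)) + r * ((s + q * P) - (1ℤ - u))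
  step-identity = solve-∀

  step-residual : ∀ v q r P → (v - q * r) * P + (1ℤ - 1ℤ) + r * 0ℤ ≡ (v - q * r) * P
  step-residual = solve-∀

  step-0 : ∀ r → + 0 * r - (r - 1ℤ) ≡ - (r - 1ℤ)
  step-0 = solve-∀

  step-1 : ∀ r → + 1 * r - (r - 1ℤ) ≡ 1ℤ
  step-1 = solve-∀

  step-fixed : ∀ r → r * r - (r - 1ℤ) ≡ normSq (r , 1ℤ)
  step-fixed r = Poly.solve 1 (λ r → r :* r :- (r :- con 1ℤ) := normSqᴾ (r , con 1ℤ)) refl r

  step-cubed : ∀ a₀ a₁ a₂ a₃ → a₂ * (a₃ - a₀) ≡
    ((a₃ * a₂ - (a₂ - 1ℤ)) - (a₂ * a₁ - (a₁ - 1ℤ)) * a₀ - (a₁ * a₀ - (a₀ - 1ℤ))) + a₂ * (a₁ * a₀ - (a₀ - 1ℤ))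
  step-cubed = solve-∀

  -- Without a root of x² − x + 1 modulo p = 2 + p₀, the map r ↦ (r − 1)/r permutes {2, …, p − 1}
  -- with order 3 and no fixed point.
  module WithoutRoot {p₀ : ℕ} (prime-p : Prime (2 ℕ.+ p₀))
                     (no-root : ∀ r → r ℕ.< 2 ℕ.+ p₀ → ¬ ((+ (2 ℕ.+ p₀)) ∣ normSq (+ r , 1ℤ))) where
    p = 2 ℕ.+ p₀
    P = + p

    point : Fin p₀ → ℕ
    point i = 2 ℕ.+ toℕ i

    point<p : ∀ i → point i ℕ.< p
    point<p i = ℕ.s≤s (ℕ.s≤s (Fin.toℕ<n i))

    opaque
      bezout : ∀ i → ∃₂ λ u v → u * + point i + v * P ≡ 1ℤ
      bezout i = primitive-bezout (cong +_ (trans (ℕ.gcd-comm (point i) p) (ℕ.coprime⇒gcd≡1 (ℕ.prime⇒coprime prime-p (point<p i)))))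

    step : Fin p₀ → ℕ
    step i = (1ℤ - proj₁ (bezout i)) %ℕ p

    step-spec : ∀ i → P ∣ + step i * + point i - (+ point i - 1ℤ)
    step-spec i = divides (v - q * r) (begin
      + step i * r - (r - 1ℤ)                                                         ≡⟨ step-identity (+ step i) u v q r P ⟩
      (v - q * r) * P + (1ℤ - (u * r + v * P)) + r * ((+ step i + q * P) - (1ℤ - u))
        ≡⟨ cong₂ (λ x y → (v - q * r) * P + (1ℤ - x) + r * y) u·r+v·p≡1 (ℤ.i≡j⇒i-j≡0 (sym (a≡a%ℕn+[a/ℕn]*n (1ℤ - u) p))) ⟩
      (v - q * r) * P + (1ℤ - 1ℤ) + r * 0ℤ                                           ≡⟨ step-residual v q r P ⟩
      (v - q * r) * P                                                                ∎)
      where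
      open ≡-Reasoning
      r = + point i
      u = proj₁ (bezout i)
      v = proj₁ (proj₂ (bezout i))
      u·r+v·p≡1 = proj₂ (proj₂ (bezout i))
      q = (1ℤ - u) /ℕ p

    not-multiple : ∀ {r} → 1 ℕ.≤ r → r ℕ.< p → ¬ (P ∣ + r)
    not-multiple {r} 1≤r r<p P∣r with residues-congruent r<p (ℕ.s≤s ℕ.z≤n) (subst (P ∣_) (sym (ℤ.+-identityʳ (+ r))) P∣r)
    ... | refl = contradiction 1≤r λ ()

    2≤step : ∀ i → 2 ℕ.≤ step i
    2≤step i = at-least-2 (step i) (step-spec i)
      where
      at-least-2 : ∀ s → P ∣ + s * + point i - (+ point i - 1ℤ) → 2 ℕ.≤ s
      at-least-2 0 P∣ = contradiction
        (residues-congruent (point<p i) (ℕ.s≤s (ℕ.s≤s ℕ.z≤n))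
          (subst (P ∣_) (trans (cong -_ (step-0 (+ point i))) (ℤ.neg-involutive _)) (∣m⇒∣-m P∣)))
        λ ()
      at-least-2 1 P∣ = contradiction (subst (P ∣_) (step-1 (+ point i)) P∣) (prime∤1 prime-p)
      at-least-2 (suc (suc _)) _ = ℕ.s≤s (ℕ.s≤s ℕ.z≤n)

    next : Fin p₀ → Fin p₀
    next i = fromℕ< (ℕ.∸-monoˡ-< (n%ℕd<d (1ℤ - proj₁ (bezout i)) p) (2≤step i))

    point-next : ∀ i → point (next i) ≡ step i
    point-next i = trans (cong (2 ℕ.+_) (Fin.toℕ-fromℕ< _)) (ℕ.m+[n∸m]≡n (2≤step i))

    relation : ∀ i → P ∣ + point (next i) * + point i - (+ point i - 1ℤ)
    relation i = subst (λ s → P ∣ + s * + point i - (+ point i - 1ℤ)) (sym (point-next i)) (step-spec i)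

    next³≡id : ∀ i → next (next (next i)) ≡ i
    next³≡id i = [ (λ P∣a₂ → contradiction P∣a₂ (not-multiple (ℕ.<-trans (ℕ.s≤s ℕ.z≤n) (ℕ.s≤s (ℕ.s≤s ℕ.z≤n))) (point<p (next (next i))))) ,
                   (λ P∣a₃-a₀ → Fin.toℕ-injective (ℕ.+-cancelˡ-≡ 2 _ _ (residues-congruent (point<p _) (point<p i) P∣a₃-a₀))) ]′
      (prime-∣-* a₂ (a₃ - a₀) prime-p (subst (P ∣_) (sym (step-cubed a₀ a₁ a₂ a₃))
        (∣m∣n⇒∣m+n (∣m∣n⇒∣m-n (∣m∣n⇒∣m-n (relation (next (next i))) (∣m⇒∣m*n a₀ (relation (next i)))) (relation i))
                   (∣n⇒∣m*n a₂ (relation i)))))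
      where
      a₀ = + point i
      a₁ = + point (next i)
      a₂ = + point (next (next i))
      a₃ = + point (next (next (next i)))

    no-fixed-point : ∀ i → next i ≢ i
    no-fixed-point i next-i≡i = no-root (point i) (point<p i)
      (subst (P ∣_) (step-fixed (+ point i)) (subst (λ j → P ∣ + point j * + point i - (+ point i - 1ℤ)) next-i≡i (relation i)))

    3∣p₀ : 3 ℕ.∣ p₀
    3∣p₀ = order-3-orbits p₀ next next³≡id no-fixed-point

-- normSq (x , 1) = x² − x + 1, whose roots modulo p are the primitive sixth roots of unity.
sixth-root-of-unity : ∀ {p} → Prime p → p % 3 ≡ 1 → ∃ λ x → (+ p) ∣ normSq (x , 1ℤ)
sixth-root-of-unity {0} prime-p = contradiction prime-p ¬prime[0]
sixth-root-of-unity {1} prime-p = contradiction prime-p ¬prime[1]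
sixth-root-of-unity {suc (suc p₀)} prime-p p%3≡1 with Fin.any? (λ (r : Fin (2 ℕ.+ p₀)) → (+ (2 ℕ.+ p₀)) ∣? normSq (+ toℕ r , 1ℤ))
... | yes (r , p∣) = + toℕ r , p∣
... | no ¬root = contradiction p%3≡1 (p%3≢1 (WithoutRoot.3∣p₀ prime-p no-root))
  where
  no-root : ∀ r → r ℕ.< 2 ℕ.+ p₀ → ¬ ((+ (2 ℕ.+ p₀)) ∣ normSq (+ r , 1ℤ))
  no-root r r<p p∣ = ¬root (fromℕ< r<p , subst (λ r → (+ (2 ℕ.+ p₀)) ∣ normSq (+ r , 1ℤ)) (sym (Fin.toℕ-fromℕ< r<p)) p∣)
  p%3≢1 : 3 ℕ.∣ p₀ → (2 ℕ.+ p₀) % 3 ≢ 1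
  p%3≢1 (ℕ.divides k refl) p%3≡1 = contradiction (trans (sym (ℕ.[m+kn]%n≡m%n 2 k 3)) p%3≡1) λ ()

-- Clean similar sublattices

product-is-norm : ∀ ps → All (λ p → Prime p × p % 3 ≡ 1) ps → ∃ λ α → Primitive α × normSq α ≡ + product ps
product-is-norm [] All.[] = 1E , refl , refl
product-is-norm (p ∷ ps) ((prime-p , p%3≡1) All.∷ rest) = extend (product-is-norm ps rest) (prime-above-p (sixth-root-of-unity prime-p p%3≡1))
  where
  prime-above-p : (∃ λ x → (+ p) ∣ normSq (x , 1ℤ)) → ∃ λ π → normSq π ≡ + p
  prime-above-p (x , p∣) = prime-norm prime-p (x , 1ℤ) p∣ (λ (_ , p∣1) → prime∤1 prime-p p∣1)
  normSq≡ : ∀ {α π′} → normSq α ≡ + product ps → normSq π′ ≡ + p → normSq (α ⊗ π′) ≡ + product (p ∷ ps)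
  normSq≡ {α} {π′} Nα≡ Nπ′≡p = trans (normSq-⊗ α π′) (trans (cong₂ _*_ Nα≡ Nπ′≡p)
    (trans (sym (ℤ.pos-* (product ps) p)) (cong +_ (ℕ.*-comm (product ps) p))))
  extend : (∃ λ α → Primitive α × normSq α ≡ + product ps) → (∃ λ π → normSq π ≡ + p) →
           ∃ λ α → Primitive α × normSq α ≡ + product (p ∷ ps)
  extend (α , prim , Nα≡) (π , Nπ≡p) with primitive-product α π prim prime-p p%3≡1 Nπ≡p
  ... | inj₁ prim-απ = α ⊗ π , prim-απ , normSq≡ {α} {π} Nα≡ Nπ≡p
  ... | inj₂ prim-απ̄ = α ⊗ conj π , prim-απ̄ , normSq≡ {α} {conj π} Nα≡ (trans (normSq-conj π) Nπ≡p)

product-≡1-mod-3 : ∀ ps → All (λ p → Prime p × p % 3 ≡ 1) ps → product ps % 3 ≡ 1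
product-≡1-mod-3 [] All.[] = refl
product-≡1-mod-3 (p ∷ ps) ((_ , p%3≡1) All.∷ rest) =
  trans (ℕ.%-distribˡ-* p (product ps) 3) (cong₂ (λ s t → (s ℕ.* t) % 3) p%3≡1 (product-≡1-mod-3 ps rest))

%3≡1⇒3∤ : ∀ c → c % 3 ≡ 1 → ¬ ((+ 3) ∣ + c)
%3≡1⇒3∤ c c%3≡1 3∣c with ∣⇒∣ᵤ 3∣c
... | ℕ.divides k refl = contradiction (trans (sym (ℕ.m*n%n≡0 k 3)) c%3≡1) λ ()

clean-similar⇒product : ∀ c → (∃[ σ ] (IsSimilarity σ × HasIndex (image σ) c × Clean (image σ))) → ProductOfPrimes1mod3 c
clean-similar⇒product c (σ , similar , index , clean) = from-lattice (similarity-image σ similar)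
  where
  from-lattice : (∃ λ α → α ≢ 0E × image σ ≐ mulLattice α) → ProductOfPrimes1mod3 c
  from-lattice (α , α≢0 , image≐αΛ) = subst ProductOfPrimes1mod3 (sym c≡N) (norm-is-product α prim 3∤N)
    where
    prim×3∤N = Equivalence.to (primitive-θ⇔ α) (clean⇒primitive α α≢0 (Clean-resp-≐ (≐-sym image≐αΛ) clean))
    prim = proj₁ prim×3∤N
    3∤N = proj₂ prim×3∤N
    c≡N : c ≡ ℤ.∣ normSq α ∣
    c≡N = index-unique {mulLattice α} (λ {y} {z} → mulLattice-congruent-sym α {y} {z})
      (λ {y} {z} {w} → mulLattice-congruent-trans α {y} {z} {w})
      (HasIndex-resp-≐ image≐αΛ index) (index-of-primitive α prim)

product⇒clean-similar : ∀ c → ProductOfPrimes1mod3 c → ∃[ σ ] (IsSimilarity σ × HasIndex (image σ) c × Clean (image σ))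
product⇒clean-similar c (ps , primes , product≡c) = from-norm (product-is-norm ps primes)
  where
  from-norm : (∃ λ α → Primitive α × normSq α ≡ + product ps) → ∃[ σ ] (IsSimilarity σ × HasIndex (image σ) c × Clean (image σ))
  from-norm (α , prim , Nα≡) =
    (α , α ⊗ ωE) ,
    rotation-isSimilarity α (primitive⇒≢0E prim) ,
    HasIndex-resp-≐ (≐-sym (image-rotation α))
      (subst (HasIndex (mulLattice α)) (trans (cong ℤ.∣_∣ Nα≡) product≡c) (index-of-primitive α prim)) ,
    Clean-resp-≐ (image-rotation α) (primitive⇒clean α (Equivalence.from (primitive-θ⇔ α) (prim , 3∤N)))
    where
    3∤N : ¬ ((+ 3) ∣ normSq α)
    3∤N = subst (λ N → ¬ ((+ 3) ∣ N)) (sym Nα≡) (%3≡1⇒3∤ (product ps) (product-≡1-mod-3 ps primes))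

theorem5 :
    (∀ (a b : ℤ) → (a , b) ≢ 0E →
      (Clean (mulLattice (a , b)) ⇔ Primitive ((a , b) ⊗ θ)))
    ×
    (∀ (c : ℕ) → 0 < c →
      ((∃[ σ ] (IsSimilarity σ × HasIndex (image σ) c × Clean (image σ)))
        ⇔ ProductOfPrimes1mod3 c))
theorem5 =
  (λ a b α≢0 → mk⇔ (clean⇒primitive (a , b) α≢0) (primitive⇒clean (a , b))) ,
  (λ c _ → mk⇔ (clean-similar⇒product c) (product⇒clean-similar c))
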